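{- Let $n\ge3$ and let $T_{W_n}(x,y)$ be the Tutte polynomial of the wheel graph $W_n$. Then $$1+T_{W_n}(1,x)=\sum_{k\ge0}a_{k,n}x^k,$$ where $a_{k,n}$ is the number of subgraphs of the cycle graph $C_n$ with $k$ edges.
   Context: $C_n$ has vertex set $[n]$ and edges $\{i,i+1\}$ ($i\in[n-1]$) and $\{n,1\}$. $W_n$ has vertex set $\{0,\dots,n\}$, the edges of $C_n$, and edges $\{0,i\}$ for all $i\in[n]$. A subgraph of $C_n$ is a pair $(A,E_A)$ with $A\subseteq[n]$ non-empty and $E_A$ a set of edges of $C_n$ with both endpoints in $A$. -}

module Defs where

open import Data.Nat as ℕ using (ℕ; zero; suc; _∸_; s≤s)
open import Data.Nat.Properties using (_<?_)
open import Data.Fin using (Fin; zero; suc; toℕ; fromℕ<)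
open import Data.Fin.Properties using (_≟_)
open import Data.Bool using (Bool; true; false; _∧_; _∨_; not; if_then_else_)
open import Data.List using (List; []; _∷_; map; _++_; length; foldr; filter; sum; allFin; concatMap)
open import Data.Bool.ListAction using (any; all)
open import Data.Product using (_×_; _,_; proj₁; proj₂)
open import Data.Integer as ℤ using (ℤ; +_)
open import Relation.Nullary using (yes; no; does)
open import Function using (_∘_)

record Graph : Set where
  field
    V : ℕ
    E : List (Fin V × Fin V)
open Graph public

-- All sub-lists of a list (= all subsets of the set of positions),
-- i.e. all spanning edge-subsets A ⊆ E.
sublists : ∀ {X : Set} → List X → List (List X)
sublists []       = [] ∷ []
sublists (e ∷ es) = let r = sublists es in r ++ map (e ∷_) r

_==_ : ∀ {m} → Fin m → Fin m → Bool
i == j = does (i ≟ j)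

step : ∀ {v} → List (Fin v × Fin v) → (Fin v → Bool) → (Fin v → Bool)
step A S w = S w ∨ any (λ e → (S (proj₁ e) ∧ (proj₂ e == w)) ∨ (S (proj₂ e) ∧ (proj₁ e == w))) A

iter : ∀ {X : Set} → ℕ → (X → X) → X → X
iter zero    f x = x
iter (suc k) f x = f (iter k f x)

-- Vertex set of the connected component of u in the spanning subgraph (Fin v, A)
-- (paths have length < v, so v growth steps suffice).
component : ∀ {v} → List (Fin v × Fin v) → Fin v → (Fin v → Bool)
component {v} A u = iter v (step A) (_== u)

count : ∀ {X : Set} → (X → Bool) → List X → ℕ
count p xs = length (filter (λ x → Data.Bool._≟_ (p x) true) xs)

-- Number of connected components k(A) of (Fin v, A): count the vertices
-- that are the least vertex of their component.
numComponents : ∀ {v} → List (Fin v × Fin v) → ℕ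
numComponents {v} A =
  count (λ u → not (any (λ w → (toℕ w ℕ.<ᵇ toℕ u) ∧ component A u w) (allFin v))) (allFin v)

rank : ∀ {v} → List (Fin v × Fin v) → ℕ
rank {v} A = v ∸ numComponents A

tutte : Graph → ℤ → ℤ → ℤ
tutte G x y =
  foldr ℤ._+_ (+ 0)
    (map (λ A → ((x ℤ.- + 1) ℤ.^ (rank (E G) ∸ rank A))
               ℤ.* ((y ℤ.- + 1) ℤ.^ (length A ∸ rank A)))
         (sublists (E G)))

-- Cycle and wheel.  Vertex i ∈ [n] of C_n is encoded as the element
-- i-1 of Fin n; next i is the cyclic successor (n ↦ 1).

next : ∀ {n} → Fin n → Fin n
next {suc m} i with suc (toℕ i) <? suc m
... | yes p = fromℕ< p
... | no  _ = zero

cycleEdges : (n : ℕ) → List (Fin n × Fin n)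
cycleEdges n = map (λ i → (i , next i)) (allFin n)

-- W_n: vertex 0 is the hub (zero : Fin (suc n)), rim vertex i is suc (i-1).
wheel : ℕ → Graph
wheel n = record
  { V = suc n
  ; E = map (λ i → (suc i , suc (next i))) (allFin n)
     ++ map (λ i → (zero , suc i)) (allFin n)
  }

-- Subgraphs of C_n: pairs (A, E_A), A ⊆ [n] non-empty, E_A a set of
-- edges of C_n (indexed by Fin n) with both endpoints in A.

subsetsFin : (n : ℕ) → List (Fin n → Bool)
subsetsFin zero    = (λ ()) ∷ []
subsetsFin (suc n) =
  concatMap (λ S → (λ { zero → false ; (suc i) → S i })
                 ∷ (λ { zero → true  ; (suc i) → S i }) ∷ []) (subsetsFin n)

card : ∀ {n} → (Fin n → Bool) → ℕ
card {n} S = count S (allFin n)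

isCycleSubgraph : ∀ {n} → (Fin n → Bool) × (Fin n → Bool) → Bool
isCycleSubgraph {n} (A , F) =
  any A (allFin n) ∧ all (λ i → not (F i) ∨ (A i ∧ A (next i))) (allFin n)

a : ℕ → ℕ → ℕ
a k n = count (λ p → isCycleSubgraph p ∧ (card (proj₂ p) ℕ.≡ᵇ k))
              (concatMap (λ A → map (A ,_) (subsetsFin n)) (subsetsFin n))

sumTo : ℕ → (ℕ → ℤ) → ℤ
sumTo zero    f = f 0
sumTo (suc m) f = sumTo m f ℤ.+ f (suc m)

{-# OPTIONS --safe #-}
module Submission where

-- Both sides equal tr(Mⁿ) − 1 for M = [[1, 1], [1, 1 + x]], with the trace written as the sum over
-- all labellings H of the rim of ∏ᵢ M(H i, H (i+1)).
--
-- Right side: for a fixed vertex set A, summing xᵏ over the subgraphs (A, E_A) gives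
-- ∏ᵢ (1 + [i ∈ A ∧ i+1 ∈ A] x); the trace also counts A = ∅, with value 1.
--
-- Left side: T(1, x) sums (x − 1)^(|F| − n) over the connected spanning edge sets F of Wₙ. Let F have
-- rim edges r and spokes p, and label rim vertex i by whether it reaches the hub by walking forward
-- along rim edges and then taking a spoke. This labelling is the unique solution of
-- H i = pᵢ ∨ (rᵢ ∧ H (i+1)), except for the bare rim cycle, which both constant labellings solve.
-- Give vertex i a weight that vanishes unless H solves the recurrence at i, also vanishes when
-- ¬rᵢ ∧ ¬H (i+1) (for the solution this happens exactly when F is disconnected), and equals x − 1
-- exactly when spoke i closes a cycle. The total weight of all labellings is then the Tutte term of F,
-- plus 2 for the bare rim. Summing the vertex weights over rᵢ and pᵢ first gives M(H i, H (i+1)),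
-- so T(1, x) + 2 = tr(Mⁿ).

open import Defs
open import Data.Bool using (Bool; true; false; _∧_; _∨_; not; if_then_else_; T; T?)
import Data.Bool.Properties as BP
open import Data.Bool.ListAction using (any; all; or; and)
open import Data.Empty using (⊥; ⊥-elim)
open import Data.Fin as F using (Fin; zero; suc; toℕ)
open import Data.Fin.Permutation using (Permutation; permutation)
import Data.Fin.Properties as FP
open import Data.Integer using (ℤ; +_; _+_; _*_; _^_; _-_)
import Data.Integer.Properties as ℤP
open import Data.Integer.Tactic.RingSolver using (solve-∀)
open import Data.List using (List; []; _∷_; map; _++_; length; foldr; tabulate; concatMap; allFin)
import Data.List.Properties as LP
open import Data.List.Membership.Propositional using (_∈_; find; lose)
open import Data.List.Membership.Propositional.Properties using (∈-allFin; ∈-map⁺; ∈-++⁺ˡ; ∈-++⁺ʳ; ∈-++⁻)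
open import Data.List.Relation.Unary.Any using (here; there)
open import Data.List.Relation.Unary.Any.Properties using (any⁺; any⁻)
open import Data.Nat as ℕ using (ℕ; zero; suc; _∸_; z≤n; s≤s; _≤_; NonZero)
open import Data.Nat.DivMod using (_%_; %-distribˡ-+; m%n%n≡m%n; m<n⇒m%n≡m; n%n≡0; [m+n]%n≡m%n; m%n<n)
import Data.Nat.Properties as ℕP
open import Data.Product using (_×_; _,_; proj₁; proj₂; ∃-syntax)
open import Data.Sum using (_⊎_; inj₁; inj₂; swap)
open import Data.Unit using (⊤; tt)
import Data.Vec.Functional as V
open import Function using (_∘_; case_of_)
open import Function.Bundles using (module Equivalence)
open import Relation.Binary.Core using (_Preserves_⟶_)
open import Relation.Binary.Construct.Closure.ReflexiveTransitive using (Star; ε; _◅_; _◅◅_)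
open import Relation.Binary.PropositionalEquality
  using (_≡_; _≢_; _≗_; refl; sym; trans; cong; cong₂; subst; module ≡-Reasoning)
open import Relation.Nullary using (¬_; ¬?; Dec; does; yes; no; _→-dec_; _⊎-dec_)
open import Relation.Nullary.Decidable using (dec-true)
open import Algebra.Properties.CommutativeMonoid.Sum ℕP.+-0-commutativeMonoid
  using (∑-distrib-+; ∑-permute) renaming (sum to ∑; sum-cong-≗ to ∑-cong)
open import Algebra.Properties.CommutativeMonoid.Sum ℤP.*-1-commutativeMonoid
  using () renaming (sum to ∏; sum-cong-≗ to ∏-cong; ∑-distrib-+ to ∏-distrib-*)

open Equivalence using (to; from)

[_]ℕ : Bool → ℕ
[ true ]ℕ = 1
[ false ]ℕ = 0

[_]ℤ : Bool → ℤ
[ true ]ℤ = + 1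
[ false ]ℤ = + 0

[∧]ℤ : ∀ a b → [ a ∧ b ]ℤ ≡ [ a ]ℤ * [ b ]ℤ
[∧]ℤ true b = sym (ℤP.*-identityˡ _)
[∧]ℤ false b = refl

¬T⇒≡false : ∀ {b} → ¬ T b → b ≡ false
¬T⇒≡false {true} ¬t = ⊥-elim (¬t tt)
¬T⇒≡false {false} _ = refl

∨-∧-unroll : ∀ a b c d e → a ∨ (b ∧ (c ∨ (d ∧ e))) ≡ (a ∨ (b ∧ c)) ∨ ((b ∧ d) ∧ e)
∨-∧-unroll true b c d e = refl
∨-∧-unroll false true c d e = refl
∨-∧-unroll false false c d e = refl

∨-absorb : ∀ a b → (T b → T a) → a ∨ b ≡ a
∨-absorb true b _ = refl
∨-absorb false false _ = refl
∨-absorb false true b⇒a = ⊥-elim (b⇒a tt)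

≢⇒≡ᵇ≡false : ∀ {m n} → m ≢ n → (m ℕ.≡ᵇ n) ≡ false
≢⇒≡ᵇ≡false {m} {n} m≢n = ¬T⇒≡false (m≢n ∘ ℕP.≡ᵇ⇒≡ m n)

[b]+[¬b]≡1 : ∀ b → [ b ]ℤ + [ not b ]ℤ ≡ + 1
[b]+[¬b]≡1 true = refl
[b]+[¬b]≡1 false = refl

==⇒≡ : ∀ {v} {i j : Fin v} → T (i == j) → i ≡ j
==⇒≡ {i = i} {j} t with i FP.≟ j
... | yes i≡j = i≡j

==-refl : ∀ {v} (i : Fin v) → T (i == i)
==-refl i with i FP.≟ i
... | yes _ = tt
... | no i≢i = ⊥-elim (i≢i refl)

∣_∣ : ∀ {n} → (Fin n → Bool) → ℕ
∣ S ∣ = ∑ (λ i → [ S i ]ℕ)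

∣∣≤n : ∀ {n} (S : Fin n → Bool) → ∣ S ∣ ≤ n
∣∣≤n {zero} S = z≤n
∣∣≤n {suc n} S with S zero
... | true = s≤s (∣∣≤n (S ∘ suc))
... | false = ℕP.m≤n⇒m≤1+n (∣∣≤n (S ∘ suc))

∣∣-zero : ∀ {n} (S : Fin n → Bool) → (∀ i → S i ≡ false) → ∣ S ∣ ≡ 0
∣∣-zero {zero} S S≡false = refl
∣∣-zero {suc n} S S≡false rewrite S≡false zero = ∣∣-zero (S ∘ suc) (S≡false ∘ suc)

∣∣-mono : ∀ {n} (S S′ : Fin n → Bool) → (∀ i → T (S i) → T (S′ i)) → ∣ S ∣ ≤ ∣ S′ ∣
∣∣-mono {zero} S S′ S⊆S′ = z≤n
∣∣-mono {suc n} S S′ S⊆S′ with S zero in eq | S′ zero in eq′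
... | true | true = s≤s (∣∣-mono (S ∘ suc) (S′ ∘ suc) (S⊆S′ ∘ suc))
... | true | false = ⊥-elim (subst T eq′ (S⊆S′ zero (subst T (sym eq) tt)))
... | false | true = ℕP.m≤n⇒m≤1+n (∣∣-mono (S ∘ suc) (S′ ∘ suc) (S⊆S′ ∘ suc))
... | false | false = ∣∣-mono (S ∘ suc) (S′ ∘ suc) (S⊆S′ ∘ suc)

∣∣-mono-< : ∀ {n} (S S′ : Fin n → Bool) → (∀ i → T (S i) → T (S′ i)) →
            ∀ w → ¬ T (S w) → T (S′ w) → suc ∣ S ∣ ≤ ∣ S′ ∣
∣∣-mono-< S S′ S⊆S′ zero ¬Sw S′w with S zero | S′ zero
... | true | _ = ⊥-elim (¬Sw tt)
... | false | false = ⊥-elim S′w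
... | false | true = s≤s (∣∣-mono (S ∘ suc) (S′ ∘ suc) (S⊆S′ ∘ suc))
∣∣-mono-< S S′ S⊆S′ (suc w) ¬Sw S′w with S zero in eq | S′ zero in eq′
... | true | true = s≤s (∣∣-mono-< (S ∘ suc) (S′ ∘ suc) (S⊆S′ ∘ suc) w ¬Sw S′w)
... | true | false = ⊥-elim (subst T eq′ (S⊆S′ zero (subst T (sym eq) tt)))
... | false | true = ℕP.m≤n⇒m≤1+n (∣∣-mono-< (S ∘ suc) (S′ ∘ suc) (S⊆S′ ∘ suc) w ¬Sw S′w)
... | false | false = ∣∣-mono-< (S ∘ suc) (S′ ∘ suc) (S⊆S′ ∘ suc) w ¬Sw S′w

∣∣-pos : ∀ {n} (S : Fin n → Bool) w → T (S w) → 1 ≤ ∣ S ∣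
∣∣-pos S zero Sw with S zero
... | true = s≤s z≤n
∣∣-pos S (suc w) Sw = ℕP.≤-trans (∣∣-pos (S ∘ suc) w Sw) (ℕP.m≤n+m _ [ S zero ]ℕ)

∑-ones : ∀ n → ∑ {n} (λ _ → 1) ≡ n
∑-ones zero = refl
∑-ones (suc n) = cong suc (∑-ones n)

count-tabulate : ∀ {X : Set} {n} (P : X → Bool) (g : Fin n → X) → count P (tabulate g) ≡ ∣ P ∘ g ∣
count-tabulate {n = zero} P g = refl
count-tabulate {n = suc n} P g with P (g zero)
... | true = cong suc (count-tabulate P (g ∘ suc))
... | false = count-tabulate P (g ∘ suc)

∏-zero : ∀ {n} (g : Fin n → ℤ) i → g i ≡ + 0 → ∏ g ≡ + 0
∏-zero g zero gi≡0 = cong (_* ∏ (g ∘ suc)) gi≡0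
∏-zero g (suc i) gi≡0 = trans (cong (g zero *_) (∏-zero (g ∘ suc) i gi≡0)) (ℤP.*-zeroʳ (g zero))

∏-one : ∀ {n} (g : Fin n → ℤ) → (∀ i → g i ≡ + 1) → ∏ g ≡ + 1
∏-one {zero} g g≡1 = refl
∏-one {suc n} g g≡1 = cong₂ _*_ (g≡1 zero) (∏-one (g ∘ suc) (g≡1 ∘ suc))

∏-if : ∀ {n} (z : ℤ) (S : Fin n → Bool) → ∏ (λ i → if S i then z else + 1) ≡ z ^ ∣ S ∣
∏-if {zero} z S = refl
∏-if {suc n} z S with S zero
... | true = cong (z *_) (∏-if z (S ∘ suc))
... | false = trans (ℤP.*-identityˡ _) (∏-if z (S ∘ suc))

^-∣∣ : ∀ {n} (x : ℤ) (S : Fin n → Bool) → x ^ ∣ S ∣ ≡ ∏ (λ i → x ^ [ S i ]ℕ)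
^-∣∣ {zero} x S = refl
^-∣∣ {suc n} x S =
  trans (ℤP.^-distribˡ-+-* x [ S zero ]ℕ ∣ S ∘ suc ∣) (cong (x ^ [ S zero ]ℕ *_) (^-∣∣ x (S ∘ suc)))

[and-tabulate]ℤ : ∀ {n} (P : Fin n → Bool) → [ and (tabulate P) ]ℤ ≡ ∏ (λ i → [ P i ]ℤ)
[and-tabulate]ℤ {zero} P = refl
[and-tabulate]ℤ {suc n} P = trans ([∧]ℤ (P zero) _) (cong ([ P zero ]ℤ *_) ([and-tabulate]ℤ (P ∘ suc)))

any-allFin-false : ∀ {n} (S : Fin n → Bool) → (∀ i → ¬ T (S i)) → any S (allFin n) ≡ false
any-allFin-false {n} S ¬S = ¬T⇒≡false (λ t → let i , _ , Si = find (any⁻ S (allFin n) t) in ¬S i Si)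

any-allFin-true : ∀ {n} (S : Fin n → Bool) i → T (S i) → any S (allFin n) ≡ true
any-allFin-true S i Si = to BP.T-≡ (any⁺ S (lose (∈-allFin i) Si))

∑⊆ : ∀ n → ((Fin n → Bool) → ℤ) → ℤ
∑⊆ zero f = f (λ ())
∑⊆ (suc n) f = ∑⊆ n (λ S → f (false V.∷ S) + f (true V.∷ S))

infixl 10 ∑⊆
syntax ∑⊆ n (λ S → e) = ∑[ S ⊆ n ] e

∑⊆-cong : ∀ n {f g : (Fin n → Bool) → ℤ} → f ≗ g → ∑⊆ n f ≡ ∑⊆ n g
∑⊆-cong zero f≗g = f≗g _
∑⊆-cong (suc n) f≗g = ∑⊆-cong n (λ S → cong₂ _+_ (f≗g (false V.∷ S)) (f≗g (true V.∷ S)))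

∑⊆-distrib-+ : ∀ n (f g : (Fin n → Bool) → ℤ) → ∑[ S ⊆ n ] (f S + g S) ≡ ∑⊆ n f + ∑⊆ n g
∑⊆-distrib-+ zero f g = refl
∑⊆-distrib-+ (suc n) f g =
  trans (∑⊆-cong n (λ S → interchange (f (false V.∷ S)) (f (true V.∷ S)) (g (false V.∷ S)) (g (true V.∷ S))))
        (∑⊆-distrib-+ n _ _)
  where
  interchange : ∀ a b c d → (a + c) + (b + d) ≡ (a + b) + (c + d)
  interchange = solve-∀

*-distribˡ-∑⊆ : ∀ n c (f : (Fin n → Bool) → ℤ) → c * ∑⊆ n f ≡ ∑[ S ⊆ n ] (c * f S)
*-distribˡ-∑⊆ zero c f = refl
*-distribˡ-∑⊆ (suc n) c f =
  trans (*-distribˡ-∑⊆ n c _) (∑⊆-cong n (λ S → ℤP.*-distribˡ-+ c (f (false V.∷ S)) (f (true V.∷ S))))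

∑⊆-comm : ∀ m n (f : (Fin m → Bool) → (Fin n → Bool) → ℤ) →
          ∑[ S ⊆ m ] ∑⊆ n (f S) ≡ ∑[ T ⊆ n ] ∑[ S ⊆ m ] f S T
∑⊆-comm zero n f = refl
∑⊆-comm (suc m) n f =
  trans (∑⊆-cong m (λ S → sym (∑⊆-distrib-+ n (f (false V.∷ S)) (f (true V.∷ S))))) (∑⊆-comm m n _)

∑⊆²-linear : ∀ m n (f g : (Fin m → Bool) → (Fin n → Bool) → ℤ) c →
             ∑[ S ⊆ m ] ∑[ T ⊆ n ] (f S T + c * g S T) ≡ ∑[ S ⊆ m ] ∑⊆ n (f S) + c * ∑[ S ⊆ m ] ∑⊆ n (g S)
∑⊆²-linear m n f g c = begin
  ∑[ S ⊆ m ] ∑[ T ⊆ n ] (f S T + c * g S T)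
    ≡⟨ ∑⊆-cong m (λ S → trans (∑⊆-distrib-+ n (f S) (λ T → c * g S T))
                             (cong (λ t → ∑⊆ n (f S) + t) (sym (*-distribˡ-∑⊆ n c (g S))))) ⟩
  ∑[ S ⊆ m ] (∑⊆ n (f S) + c * ∑⊆ n (g S))
    ≡⟨ ∑⊆-distrib-+ m (λ S → ∑⊆ n (f S)) (λ S → c * ∑⊆ n (g S)) ⟩
  ∑[ S ⊆ m ] ∑⊆ n (f S) + ∑[ S ⊆ m ] (c * ∑⊆ n (g S))
    ≡⟨ cong (λ t → ∑[ S ⊆ m ] ∑⊆ n (f S) + t) (*-distribˡ-∑⊆ m c (λ S → ∑⊆ n (g S))) ⟨
  ∑[ S ⊆ m ] ∑⊆ n (f S) + c * ∑[ S ⊆ m ] ∑⊆ n (g S) ∎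
  where open ≡-Reasoning

∑⊆-∏ : ∀ n (φ : Fin n → Bool → ℤ) → ∑[ S ⊆ n ] ∏ (λ i → φ i (S i)) ≡ ∏ (λ i → φ i false + φ i true)
∑⊆-∏ zero φ = refl
∑⊆-∏ (suc n) φ = begin
  ∑[ S ⊆ n ] (φ₀ false * P S + φ₀ true * P S) ≡⟨ ∑⊆-cong n (λ S → ℤP.*-distribʳ-+ (P S) (φ₀ false) (φ₀ true)) ⟨
  ∑[ S ⊆ n ] ((φ₀ false + φ₀ true) * P S)     ≡⟨ *-distribˡ-∑⊆ n (φ₀ false + φ₀ true) P ⟨
  (φ₀ false + φ₀ true) * ∑⊆ n P               ≡⟨ cong ((φ₀ false + φ₀ true) *_) (∑⊆-∏ n (φ ∘ suc)) ⟩
  (φ₀ false + φ₀ true) * ∏ (λ i → φ (suc i) false + φ (suc i) true) ∎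
  where
  open ≡-Reasoning
  φ₀ : Bool → ℤ
  φ₀ = φ zero
  P : (Fin n → Bool) → ℤ
  P S = ∏ (λ i → φ (suc i) (S i))

∑⊆-single : ∀ n (f : (Fin n → Bool) → ℤ) (S₀ : Fin n → Bool) → f Preserves _≗_ ⟶ _≡_ →
            (∀ S → ¬ S ≗ S₀ → f S ≡ + 0) → ∑⊆ n f ≡ f S₀
∑⊆-single zero f S₀ f-resp f-vanish = f-resp (λ ())
∑⊆-single (suc n) f S₀ f-resp f-vanish = begin
  ∑[ S ⊆ n ] (f (false V.∷ S) + f (true V.∷ S)) ≡⟨ ∑⊆-cong n (λ S → other-branch-vanishes S (S₀ zero) refl) ⟩
  ∑[ S ⊆ n ] f (S₀ zero V.∷ S)                  ≡⟨ ∑⊆-single n _ (S₀ ∘ suc) tail-resp tail-vanish ⟩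
  f (S₀ zero V.∷ (S₀ ∘ suc))                    ≡⟨ f-resp (λ { zero → refl ; (suc i) → refl }) ⟩
  f S₀                                          ∎
  where
  open ≡-Reasoning
  tail-resp : (λ S → f (S₀ zero V.∷ S)) Preserves _≗_ ⟶ _≡_
  tail-resp S≗T = f-resp (λ { zero → refl ; (suc i) → S≗T i })
  tail-vanish : ∀ S → ¬ S ≗ (S₀ ∘ suc) → f (S₀ zero V.∷ S) ≡ + 0
  tail-vanish S S≉ = f-vanish _ (λ eq → S≉ (eq ∘ suc))
  other-branch-vanishes : ∀ S b → S₀ zero ≡ b → f (false V.∷ S) + f (true V.∷ S) ≡ f (b V.∷ S)
  other-branch-vanishes S false eq =
    trans (cong (λ t → f (false V.∷ S) + t) (f-vanish (true V.∷ S) (λ e → case trans (e zero) eq of λ ())))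
          (ℤP.+-identityʳ _)
  other-branch-vanishes S true eq =
    trans (cong (_+ f (true V.∷ S)) (f-vanish (false V.∷ S) (λ e → case trans (e zero) eq of λ ()))) (ℤP.+-identityˡ _)

∑ᴸ : ∀ {X : Set} → (X → ℤ) → List X → ℤ
∑ᴸ f xs = foldr _+_ (+ 0) (map f xs)

∑ᴸ-++ : ∀ {X : Set} (f : X → ℤ) xs ys → ∑ᴸ f (xs ++ ys) ≡ ∑ᴸ f xs + ∑ᴸ f ys
∑ᴸ-++ f [] ys = sym (ℤP.+-identityˡ _)
∑ᴸ-++ f (x ∷ xs) ys = trans (cong (λ t → f x + t) (∑ᴸ-++ f xs ys)) (sym (ℤP.+-assoc (f x) _ _))

∑ᴸ-cong : ∀ {X : Set} {f g : X → ℤ} → f ≗ g → ∀ xs → ∑ᴸ f xs ≡ ∑ᴸ g xs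
∑ᴸ-cong f≗g [] = refl
∑ᴸ-cong f≗g (x ∷ xs) = cong₂ _+_ (f≗g x) (∑ᴸ-cong f≗g xs)

∑ᴸ-map : ∀ {X Y : Set} (f : Y → ℤ) (g : X → Y) xs → ∑ᴸ f (map g xs) ≡ ∑ᴸ (f ∘ g) xs
∑ᴸ-map f g xs = cong (foldr _+_ (+ 0)) (sym (LP.map-∘ xs))

∑ᴸ-concatMap : ∀ {X Y : Set} (f : Y → ℤ) (h : X → List Y) xs → ∑ᴸ f (concatMap h xs) ≡ ∑ᴸ (∑ᴸ f ∘ h) xs
∑ᴸ-concatMap f h [] = refl
∑ᴸ-concatMap f h (x ∷ xs) = trans (∑ᴸ-++ f (h x) (concatMap h xs)) (cong (λ t → ∑ᴸ f (h x) + t) (∑ᴸ-concatMap f h xs))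

∑ᴸ-sublists-++ : ∀ {X : Set} (f : List X → ℤ) xs ys →
                 ∑ᴸ f (sublists (xs ++ ys)) ≡ ∑ᴸ (λ as → ∑ᴸ (λ bs → f (as ++ bs)) (sublists ys)) (sublists xs)
∑ᴸ-sublists-++ f [] ys = sym (ℤP.+-identityʳ _)
∑ᴸ-sublists-++ f (x ∷ xs) ys = begin
  ∑ᴸ f (sublists (xs ++ ys) ++ map (x ∷_) (sublists (xs ++ ys)))
    ≡⟨ ∑ᴸ-++ f (sublists (xs ++ ys)) _ ⟩
  ∑ᴸ f (sublists (xs ++ ys)) + ∑ᴸ f (map (x ∷_) (sublists (xs ++ ys)))
    ≡⟨ cong₂ _+_ (∑ᴸ-sublists-++ f xs ys)
                 (trans (∑ᴸ-map f (x ∷_) (sublists (xs ++ ys))) (∑ᴸ-sublists-++ (f ∘ (x ∷_)) xs ys)) ⟩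
  F (sublists xs) + ∑ᴸ (λ as → ∑ᴸ (λ bs → f (x ∷ as ++ bs)) (sublists ys)) (sublists xs)
    ≡⟨ cong (λ t → F (sublists xs) + t) (∑ᴸ-map G (x ∷_) (sublists xs)) ⟨
  F (sublists xs) + F (map (x ∷_) (sublists xs))
    ≡⟨ ∑ᴸ-++ G (sublists xs) _ ⟨
  F (sublists xs ++ map (x ∷_) (sublists xs)) ∎
  where
  open ≡-Reasoning
  G : List _ → ℤ
  G as = ∑ᴸ (λ bs → f (as ++ bs)) (sublists ys)
  F : List (List _) → ℤ
  F = ∑ᴸ G

select : ∀ {X : Set} {n} → (Fin n → X) → (Fin n → Bool) → List X
select {n = zero} g S = []
select {n = suc n} g S = if S zero then g zero ∷ select (g ∘ suc) (S ∘ suc) else select (g ∘ suc) (S ∘ suc)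

∈-select⁺ : ∀ {X : Set} {n} (g : Fin n → X) (S : Fin n → Bool) {i} → T (S i) → g i ∈ select g S
∈-select⁺ g S {zero} Si with S zero
... | true = here refl
∈-select⁺ g S {suc i} Si with S zero
... | true = there (∈-select⁺ (g ∘ suc) (S ∘ suc) Si)
... | false = ∈-select⁺ (g ∘ suc) (S ∘ suc) Si

∈-select⁻ : ∀ {X : Set} {n} (g : Fin n → X) (S : Fin n → Bool) {e} → e ∈ select g S → ∃[ i ] (T (S i) × e ≡ g i)
∈-select⁻ {n = suc n} g S e∈ with S zero in eq
∈-select⁻ {n = suc n} g S (here refl) | true = zero , subst T (sym eq) tt , refl
∈-select⁻ {n = suc n} g S (there e∈) | true =
  let i , Si , e≡gi = ∈-select⁻ (g ∘ suc) (S ∘ suc) e∈ in suc i , Si , e≡gi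
∈-select⁻ {n = suc n} g S e∈ | false =
  let i , Si , e≡gi = ∈-select⁻ (g ∘ suc) (S ∘ suc) e∈ in suc i , Si , e≡gi

length-select : ∀ {X : Set} {n} (g : Fin n → X) (S : Fin n → Bool) → length (select g S) ≡ ∣ S ∣
length-select {n = zero} g S = refl
length-select {n = suc n} g S with S zero
... | true = cong suc (length-select (g ∘ suc) (S ∘ suc))
... | false = length-select (g ∘ suc) (S ∘ suc)

∑ᴸ-sublists-tabulate : ∀ {X : Set} n (f : List X → ℤ) (g : Fin n → X) →
                       ∑ᴸ f (sublists (tabulate g)) ≡ ∑[ S ⊆ n ] f (select g S)
∑ᴸ-sublists-tabulate zero f g = ℤP.+-identityʳ _
∑ᴸ-sublists-tabulate (suc n) f g = begin
  ∑ᴸ f (sublists gs ++ map (g zero ∷_) (sublists gs))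
    ≡⟨ ∑ᴸ-++ f (sublists gs) _ ⟩
  ∑ᴸ f (sublists gs) + ∑ᴸ f (map (g zero ∷_) (sublists gs))
    ≡⟨ cong₂ _+_ (∑ᴸ-sublists-tabulate n f (g ∘ suc))
                 (trans (∑ᴸ-map f (g zero ∷_) (sublists gs)) (∑ᴸ-sublists-tabulate n (f ∘ (g zero ∷_)) (g ∘ suc))) ⟩
  ∑[ S ⊆ n ] f (select (g ∘ suc) S) + ∑[ S ⊆ n ] f (g zero ∷ select (g ∘ suc) S)
    ≡⟨ ∑⊆-distrib-+ n _ _ ⟨
  ∑[ S ⊆ suc n ] f (select g S) ∎
  where
  open ≡-Reasoning
  gs : List _
  gs = tabulate (g ∘ suc)

∑ᴸ-subsetsFin : ∀ n (f : (Fin n → Bool) → ℤ) → f Preserves _≗_ ⟶ _≡_ → ∑ᴸ f (subsetsFin n) ≡ ∑⊆ n f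
∑ᴸ-subsetsFin zero f f-resp = trans (ℤP.+-identityʳ _) (f-resp (λ ()))
∑ᴸ-subsetsFin (suc n) f f-resp =
  trans (∑ᴸ-concatMap f _ (subsetsFin n))
        (trans (∑ᴸ-subsetsFin n _ (λ S≗T → cong₂ _+_ (f-resp (λ { zero → refl ; (suc i) → S≗T i }))
                                                     (cong (_+ + 0) (f-resp (λ { zero → refl ; (suc i) → S≗T i })))))
               (∑⊆-cong n (λ S → cong₂ _+_ (f-resp (λ { zero → refl ; (suc i) → refl }))
                                          (trans (ℤP.+-identityʳ _) (f-resp (λ { zero → refl ; (suc i) → refl }))))))

count-∷ : ∀ {X : Set} (P : X → Bool) q xs → + count P (q ∷ xs) ≡ [ P q ]ℤ + + count P xs
count-∷ P q xs with P q
... | true = refl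
... | false = sym (ℤP.+-identityˡ _)

sumTo-cong : ∀ N {f g : ℕ → ℤ} → (∀ k → k ≤ N → f k ≡ g k) → sumTo N f ≡ sumTo N g
sumTo-cong zero f≡g = f≡g 0 z≤n
sumTo-cong (suc N) f≡g = cong₂ _+_ (sumTo-cong N (λ k k≤N → f≡g k (ℕP.m≤n⇒m≤1+n k≤N))) (f≡g (suc N) ℕP.≤-refl)

sumTo-zero : ∀ N → sumTo N (λ _ → + 0) ≡ + 0
sumTo-zero zero = refl
sumTo-zero (suc N) = cong (_+ + 0) (sumTo-zero N)

sumTo-distrib-+ : ∀ N (f g : ℕ → ℤ) → sumTo N (λ k → f k + g k) ≡ sumTo N f + sumTo N g
sumTo-distrib-+ zero f g = refl
sumTo-distrib-+ (suc N) f g =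
  trans (cong (_+ (f (suc N) + g (suc N))) (sumTo-distrib-+ N f g))
        (interchange (sumTo N f) (sumTo N g) (f (suc N)) (g (suc N)))
  where
  interchange : ∀ a b c d → (a + b) + (c + d) ≡ (a + c) + (b + d)
  interchange = solve-∀

*-distribˡ-sumTo : ∀ N c (f : ℕ → ℤ) → c * sumTo N f ≡ sumTo N (λ k → c * f k)
*-distribˡ-sumTo zero c f = refl
*-distribˡ-sumTo (suc N) c f = trans (ℤP.*-distribˡ-+ c (sumTo N f) (f (suc N))) (cong (_+ c * f (suc N)) (*-distribˡ-sumTo N c f))

sumTo-indicator : ∀ (x : ℤ) N c → c ≤ N → sumTo N (λ k → [ c ℕ.≡ᵇ k ]ℤ * x ^ k) ≡ x ^ c
sumTo-indicator x zero zero z≤n = refl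
sumTo-indicator x (suc N) c c≤N+1 with ℕP.m≤n⇒m<n∨m≡n c≤N+1
... | inj₁ (s≤s c≤N) = begin
  sumTo N (λ k → [ c ℕ.≡ᵇ k ]ℤ * x ^ k) + [ c ℕ.≡ᵇ suc N ]ℤ * x ^ suc N
    ≡⟨ cong₂ _+_ (sumTo-indicator x N c c≤N) (cong (λ b → [ b ]ℤ * x ^ suc N) (≢⇒≡ᵇ≡false (ℕP.<⇒≢ (s≤s c≤N)))) ⟩
  x ^ c + + 0
    ≡⟨ ℤP.+-identityʳ (x ^ c) ⟩
  x ^ c ∎
  where open ≡-Reasoning
... | inj₂ refl = begin
  sumTo N (λ k → [ suc N ℕ.≡ᵇ k ]ℤ * x ^ k) + [ suc N ℕ.≡ᵇ suc N ]ℤ * x ^ suc N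
    ≡⟨ cong₂ _+_ (trans (sumTo-cong N (λ k k≤N → cong (λ b → [ b ]ℤ * x ^ k) (≢⇒≡ᵇ≡false (ℕP.<⇒≢ (s≤s k≤N) ∘ sym))))
                        (sumTo-zero N))
                 (cong (λ b → [ b ]ℤ * x ^ suc N) (to BP.T-≡ (ℕP.≡⇒≡ᵇ N N refl))) ⟩
  + 0 + + 1 * x ^ suc N
    ≡⟨ trans (ℤP.+-identityˡ _) (ℤP.*-identityˡ _) ⟩
  x ^ suc N ∎
  where open ≡-Reasoning

sumTo-count : ∀ {X : Set} (x : ℤ) N (b : X → Bool) (c : X → ℕ) → (∀ q → c q ≤ N) → ∀ xs →
              sumTo N (λ k → + count (λ q → b q ∧ (c q ℕ.≡ᵇ k)) xs * x ^ k) ≡ ∑ᴸ (λ q → [ b q ]ℤ * x ^ c q) xs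
sumTo-count x N b c c≤N [] = sumTo-zero N
sumTo-count x N b c c≤N (q ∷ xs) = begin
  sumTo N (λ k → + count (P k) (q ∷ xs) * x ^ k)
    ≡⟨ sumTo-cong N (λ k _ → trans (cong (_* x ^ k) (count-∷ (P k) q xs)) (ℤP.*-distribʳ-+ (x ^ k) [ P k q ]ℤ _)) ⟩
  sumTo N (λ k → [ P k q ]ℤ * x ^ k + + count (P k) xs * x ^ k)
    ≡⟨ sumTo-distrib-+ N _ _ ⟩
  sumTo N (λ k → [ b q ∧ (c q ℕ.≡ᵇ k) ]ℤ * x ^ k) + sumTo N (λ k → + count (P k) xs * x ^ k)
    ≡⟨ cong₂ _+_ head-term (sumTo-count x N b c c≤N xs) ⟩
  [ b q ]ℤ * x ^ c q + ∑ᴸ (λ q → [ b q ]ℤ * x ^ c q) xs ∎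
  where
  open ≡-Reasoning
  P : ℕ → _ → Bool
  P k q = b q ∧ (c q ℕ.≡ᵇ k)
  head-term : sumTo N (λ k → [ b q ∧ (c q ℕ.≡ᵇ k) ]ℤ * x ^ k) ≡ [ b q ]ℤ * x ^ c q
  head-term = begin
    sumTo N (λ k → [ b q ∧ (c q ℕ.≡ᵇ k) ]ℤ * x ^ k)
      ≡⟨ sumTo-cong N (λ k _ → trans (cong (_* x ^ k) ([∧]ℤ (b q) (c q ℕ.≡ᵇ k))) (ℤP.*-assoc [ b q ]ℤ _ (x ^ k))) ⟩
    sumTo N (λ k → [ b q ]ℤ * ([ c q ℕ.≡ᵇ k ]ℤ * x ^ k))
      ≡⟨ *-distribˡ-sumTo N [ b q ]ℤ (λ k → [ c q ℕ.≡ᵇ k ]ℤ * x ^ k) ⟨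
    [ b q ]ℤ * sumTo N (λ k → [ c q ℕ.≡ᵇ k ]ℤ * x ^ k)
      ≡⟨ cong ([ b q ]ℤ *_) (sumTo-indicator x N (c q) (c≤N q)) ⟩
    [ b q ]ℤ * x ^ c q ∎

-- The cyclic order on Fin n

[m%n+k]%n≡[m+k]%n : ∀ m k n .{{_ : NonZero n}} → (m % n ℕ.+ k) % n ≡ (m ℕ.+ k) % n
[m%n+k]%n≡[m+k]%n m k n = begin
  (m % n ℕ.+ k) % n         ≡⟨ %-distribˡ-+ (m % n) k n ⟩
  (m % n % n ℕ.+ k % n) % n ≡⟨ cong (λ t → (t ℕ.+ k % n) % n) (m%n%n≡m%n m n) ⟩
  (m % n ℕ.+ k % n) % n     ≡⟨ %-distribˡ-+ m k n ⟨
  (m ℕ.+ k) % n             ∎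
  where open ≡-Reasoning

iterate : ∀ {X : Set} → (X → X) → ℕ → X → X
iterate f zero x = x
iterate f (suc k) x = iterate f k (f x)

iterate-comm : ∀ {X : Set} (f : X → X) k x → iterate f k (f x) ≡ f (iterate f k x)
iterate-comm f zero x = refl
iterate-comm f (suc k) x = iterate-comm f k (f x)

module _ {m : ℕ} where
  private
    n : ℕ
    n = suc m

  toℕ-next : ∀ (i : Fin n) → toℕ (next i) ≡ suc (toℕ i) % n
  toℕ-next i with suc (toℕ i) ℕP.<? n
  ... | yes i+1<n = trans (FP.toℕ-fromℕ< i+1<n) (sym (m<n⇒m%n≡m i+1<n))
  ... | no i+1≮n = trans (sym (n%n≡0 n)) (cong (_% n) (ℕP.≤-antisym (ℕP.≮⇒≥ i+1≮n) (FP.toℕ<n i)))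

  toℕ-iterate-next : ∀ k (i : Fin n) → toℕ (iterate next k i) ≡ (toℕ i ℕ.+ k) % n
  toℕ-iterate-next zero i = sym (trans (cong (_% n) (ℕP.+-identityʳ (toℕ i))) (m<n⇒m%n≡m (FP.toℕ<n i)))
  toℕ-iterate-next (suc k) i = begin
    toℕ (iterate next k (next i))     ≡⟨ toℕ-iterate-next k (next i) ⟩
    (toℕ (next i) ℕ.+ k) % n          ≡⟨ cong (λ t → (t ℕ.+ k) % n) (toℕ-next i) ⟩
    (suc (toℕ i) % n ℕ.+ k) % n       ≡⟨ [m%n+k]%n≡[m+k]%n (suc (toℕ i)) k n ⟩
    (suc (toℕ i) ℕ.+ k) % n           ≡⟨ cong (_% n) (ℕP.+-suc (toℕ i) k) ⟨
    (toℕ i ℕ.+ suc k) % n             ∎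
    where open ≡-Reasoning

  iterate-next-period : ∀ (i : Fin n) → iterate next n i ≡ i
  iterate-next-period i = FP.toℕ-injective (begin
    toℕ (iterate next n i)  ≡⟨ toℕ-iterate-next n i ⟩
    (toℕ i ℕ.+ n) % n       ≡⟨ [m+n]%n≡m%n (toℕ i) n ⟩
    toℕ i % n               ≡⟨ m<n⇒m%n≡m (FP.toℕ<n i) ⟩
    toℕ i                   ∎)
    where open ≡-Reasoning

  next-reaches : ∀ (i j : Fin n) → ∃[ k ] (k ℕ.< n × iterate next k i ≡ j)
  next-reaches i j = k , m%n<n d n , FP.toℕ-injective (begin
    toℕ (iterate next k i)      ≡⟨ toℕ-iterate-next k i ⟩
    (toℕ i ℕ.+ k) % n           ≡⟨ cong (_% n) (ℕP.+-comm (toℕ i) k) ⟩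
    (k ℕ.+ toℕ i) % n           ≡⟨ [m%n+k]%n≡[m+k]%n d (toℕ i) n ⟩
    (d ℕ.+ toℕ i) % n           ≡⟨ cong (_% n) d+i≡j+n ⟩
    (toℕ j ℕ.+ n) % n           ≡⟨ [m+n]%n≡m%n (toℕ j) n ⟩
    toℕ j % n                   ≡⟨ m<n⇒m%n≡m (FP.toℕ<n j) ⟩
    toℕ j                       ∎)
    where
    open ≡-Reasoning
    d k : ℕ
    d = n ∸ toℕ i ℕ.+ toℕ j
    k = d % n
    d+i≡j+n : d ℕ.+ toℕ i ≡ toℕ j ℕ.+ n
    d+i≡j+n = begin
      n ∸ toℕ i ℕ.+ toℕ j ℕ.+ toℕ i   ≡⟨ ℕP.+-assoc (n ∸ toℕ i) (toℕ j) (toℕ i) ⟩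
      n ∸ toℕ i ℕ.+ (toℕ j ℕ.+ toℕ i) ≡⟨ cong (n ∸ toℕ i ℕ.+_) (ℕP.+-comm (toℕ j) (toℕ i)) ⟩
      n ∸ toℕ i ℕ.+ (toℕ i ℕ.+ toℕ j) ≡⟨ ℕP.+-assoc (n ∸ toℕ i) (toℕ i) (toℕ j) ⟨
      n ∸ toℕ i ℕ.+ toℕ i ℕ.+ toℕ j   ≡⟨ cong (ℕ._+ toℕ j) (ℕP.m∸n+n≡m (ℕP.<⇒≤ (FP.toℕ<n i))) ⟩
      n ℕ.+ toℕ j                     ≡⟨ ℕP.+-comm n (toℕ j) ⟩
      toℕ j ℕ.+ n                     ∎

  prev : Fin n → Fin n
  prev = iterate next m

  next-prev : ∀ (i : Fin n) → next (prev i) ≡ i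
  next-prev i = trans (sym (iterate-comm next m i)) (iterate-next-period i)

  prev-next : ∀ (i : Fin n) → prev (next i) ≡ i
  prev-next = iterate-next-period

  next-injective : ∀ {i j : Fin n} → next i ≡ next j → i ≡ j
  next-injective {i} {j} eq = trans (sym (prev-next i)) (trans (cong prev eq) (prev-next j))

  rotation : Permutation n n
  rotation = permutation next prev next-prev prev-next

  ∑-rotate : ∀ (g : Fin n → ℕ) → ∑ (g ∘ next) ≡ ∑ g
  ∑-rotate g = sym (∑-permute g rotation)

-- Connected components

module Connectivity {v : ℕ} (A : List (Fin v × Fin v)) where

  Adjacent : Fin v → Fin v → Set
  Adjacent a b = (a , b) ∈ A ⊎ (b , a) ∈ A

  Path : Fin v → Fin v → Set
  Path = Star Adjacent

  ReachableFrom : Fin v → (Fin v → Bool) → Set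
  ReachableFrom u S = ∀ x → T (S x) → Path u x

  step-reachable : ∀ {u S} → ReachableFrom u S → ReachableFrom u (step A S)
  step-reachable {u} {S} reach w t with to BP.T-∨ t
  ... | inj₁ Sw = reach w Sw
  ... | inj₂ viaEdge with find (any⁻ _ A viaEdge)
  ...   | (a , b) , ab∈A , t′ with to BP.T-∨ t′
  ...     | inj₁ Sa∧b==w = let Sa , b==w = to BP.T-∧ Sa∧b==w
                          in subst (Path u) (==⇒≡ b==w) (reach a Sa ◅◅ inj₁ ab∈A ◅ ε)
  ...     | inj₂ Sb∧a==w = let Sb , a==w = to BP.T-∧ Sb∧a==w
                          in subst (Path u) (==⇒≡ a==w) (reach b Sb ◅◅ inj₂ ab∈A ◅ ε)

  reached : Fin v → ℕ → Fin v → Bool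
  reached u k = iter k (step A) (_== u)

  reached-reachable : ∀ u k → ReachableFrom u (reached u k)
  reached-reachable u zero x x==u = subst (Path u) (sym (==⇒≡ x==u)) ε
  reached-reachable u (suc k) = step-reachable (reached-reachable u k)

  component-sound : ∀ u w → T (component A u w) → Path u w
  component-sound u = reached-reachable u v

  step-adjacent : ∀ S {a b} → Adjacent a b → T (S a) → T (step A S b)
  step-adjacent S {a} {b} (inj₁ ab∈A) Sa =
    from BP.T-∨ (inj₂ (any⁺ _ (lose ab∈A (from BP.T-∨ (inj₁ (from BP.T-∧ (Sa , ==-refl b)))))))
  step-adjacent S {a} {b} (inj₂ ba∈A) Sa =
    from BP.T-∨ (inj₂ (any⁺ _ (lose ba∈A (from BP.T-∨ (inj₂ (from BP.T-∧ (Sa , ==-refl b)))))))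

  step-inflationary : ∀ S w → S w ≡ true → step A S w ≡ true
  step-inflationary S w Sw rewrite Sw = refl

  step-cong : ∀ {S S′} → S ≗ S′ → step A S ≗ step A S′
  step-cong S≗S′ w = cong₂ _∨_ (S≗S′ w) (cong or (LP.map-cong (λ e → cong₂ _∨_ (cong (_∧ _) (S≗S′ (proj₁ e)))
                                                                              (cong (_∧ _) (S≗S′ (proj₂ e)))) A))

  Closed : (Fin v → Bool) → Set
  Closed S = step A S ≗ S

  closed-path : ∀ {S u w} → Closed S → T (S u) → Path u w → T (S w)
  closed-path closed Su ε = Su
  closed-path {S} closed Su (adj ◅ path) = closed-path closed (subst T (closed _) (step-adjacent S adj Su)) path

  reached-saturates : ∀ u k → Closed (reached u k) ⊎ suc k ≤ ∣ reached u k ∣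
  reached-saturates u zero = inj₂ (∣∣-pos (reached u zero) u (==-refl u))
  reached-saturates u (suc k) with FP.all? (λ w → step A (reached u k) w BP.≟ reached u k w)
  ... | yes closed = inj₁ (step-cong closed)
  ... | no ¬closed with reached-saturates u k
  ...   | inj₁ closed = ⊥-elim (¬closed closed)
  ...   | inj₂ k<∣S∣ with FP.¬∀⟶∃¬ v _ (λ w → step A (reached u k) w BP.≟ reached u k w) ¬closed
  ...     | w , grows = let ¬Sw , S′w = strict-growth _ _ (step-inflationary (reached u k) w) grows in
    inj₂ (ℕP.≤-trans (s≤s k<∣S∣) (∣∣-mono-< (reached u k) (reached u (suc k)) inflate w ¬Sw S′w))
    where
    inflate : ∀ x → T (reached u k x) → T (reached u (suc k) x)
    inflate x Sx = from BP.T-≡ (step-inflationary (reached u k) x (to BP.T-≡ Sx))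
    strict-growth : ∀ b b′ → (b ≡ true → b′ ≡ true) → b′ ≢ b → ¬ T b × T b′
    strict-growth false true _ _ = (λ ()) , tt
    strict-growth false false _ b′≢b = ⊥-elim (b′≢b refl)
    strict-growth true b′ b⇒b′ b′≢b = ⊥-elim (b′≢b (b⇒b′ refl))

  component-closed : ∀ u → Closed (component A u)
  component-closed u with reached-saturates u v
  ... | inj₁ closed = closed
  ... | inj₂ v<∣S∣ = ⊥-elim (ℕP.<-irrefl refl (ℕP.<-≤-trans v<∣S∣ (∣∣≤n (component A u))))

  component-complete : ∀ u w → Path u w → T (component A u w)
  component-complete u w = closed-path (component-closed u) (reached-self v)
    where
    reached-self : ∀ k → T (reached u k u)
    reached-self zero = ==-refl u
    reached-self (suc k) = from BP.T-≡ (step-inflationary (reached u k) u (to BP.T-≡ (reached-self k)))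

  path? : ∀ u w → Dec (Path u w)
  path? u w with T? (component A u w)
  ... | yes t = yes (component-sound u w t)
  ... | no ¬t = no (¬t ∘ component-complete u w)

module Components {n : ℕ} (A : List (Fin (suc n) × Fin (suc n))) where
  open Connectivity A

  reachesBelow : Fin (suc n) → Fin (suc n) → Bool
  reachesBelow u w = (toℕ w ℕ.<ᵇ toℕ u) ∧ component A u w

  isLeast : Fin (suc n) → Bool
  isLeast u = not (any (reachesBelow u) (allFin (suc n)))

  numComponents≡1+∣isLeast∘suc∣ : numComponents A ≡ 1 ℕ.+ ∣ isLeast ∘ suc ∣
  numComponents≡1+∣isLeast∘suc∣ = trans (count-tabulate isLeast (λ i → i)) (cong (ℕ._+ ∣ isLeast ∘ suc ∣) zero-isLeast)
    where
    zero-isLeast : [ isLeast zero ]ℕ ≡ 1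
    zero-isLeast with any (reachesBelow zero) (allFin (suc n)) in eq
    ... | false = refl
    ... | true = ⊥-elim (proj₂ (proj₂ (find (any⁻ (reachesBelow zero) (allFin (suc n)) (subst T (sym eq) tt)))))

  connected⇒numComponents≡1 : (∀ u → Path u zero) → numComponents A ≡ 1
  connected⇒numComponents≡1 connected = trans numComponents≡1+∣isLeast∘suc∣ (cong suc (∣∣-zero (isLeast ∘ suc) suc-notLeast))
    where
    suc-notLeast : ∀ i → isLeast (suc i) ≡ false
    suc-notLeast i = cong not (to BP.T-≡ (any⁺ (reachesBelow (suc i))
                       (lose (∈-allFin zero) (component-complete (suc i) zero (connected (suc i))))))

  disconnected⇒2≤numComponents : ∀ u → ¬ Path u zero → 2 ≤ numComponents A
  disconnected⇒2≤numComponents u ¬path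
    with FP.¬∀⟶∃¬-smallest (suc n) (λ x → Path x zero) (λ x → path? x zero) (λ all → ¬path (all u))
  ... | zero , ¬path₀ , _ = ⊥-elim (¬path₀ ε)
  ... | suc i , ¬pathᵢ , smaller-connected =
    subst (2 ≤_) (sym numComponents≡1+∣isLeast∘suc∣) (s≤s (∣∣-pos (isLeast ∘ suc) i (from BP.T-not-≡ no-smaller-rep)))
    where
    no-smaller-rep : any (reachesBelow (suc i)) (allFin (suc n)) ≡ false
    no-smaller-rep with any (reachesBelow (suc i)) (allFin (suc n)) in eq
    ... | false = refl
    ... | true with find (any⁻ (reachesBelow (suc i)) (allFin (suc n)) (subst T (sym eq) tt))
    ...   | w , _ , t = let w<i+1 , comp = to BP.T-∧ t
                            j = F.fromℕ< (ℕP.<ᵇ⇒< (toℕ w) (toℕ (suc i)) w<i+1)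
                            inject-j≡w = FP.toℕ-injective (trans (FP.toℕ-inject j) (FP.toℕ-fromℕ< _))
                        in ⊥-elim (¬pathᵢ (component-sound (suc i) w comp ◅◅
                                           subst (λ x → Path x zero) inject-j≡w (smaller-connected j)))

-- Spanning subgraphs of the wheel

tutteTerm : (G : Graph) → ℤ → ℤ → List (Fin (V G) × Fin (V G)) → ℤ
tutteTerm G x y A = ((x - + 1) ^ (rank (E G) ∸ rank A)) * ((y - + 1) ^ (length A ∸ rank A))

rimEdge spokeEdge : ∀ {n} → Fin n → Fin (suc n) × Fin (suc n)
rimEdge i = suc i , suc (next i)
spokeEdge i = zero , suc i

E-wheel : ∀ n → E (wheel n) ≡ tabulate rimEdge ++ tabulate spokeEdge
E-wheel n = cong₂ _++_ (LP.map-tabulate (λ i → i) rimEdge) (LP.map-tabulate (λ i → i) spokeEdge)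

rank-wheel : ∀ m → rank (E (wheel (suc m))) ≡ suc m
rank-wheel m = cong (suc (suc m) ∸_) (connected⇒numComponents≡1 spoke-path)
  where
  open Connectivity (E (wheel (suc m)))
  open Components (E (wheel (suc m)))
  spoke-path : ∀ u → Path u zero
  spoke-path zero = ε
  spoke-path (suc i) = inj₂ (∈-++⁺ʳ (map _ (allFin (suc m))) (∈-map⁺ _ (∈-allFin i))) ◅ ε

module WheelTerm {m : ℕ} (x : ℤ) (A : List (Fin (suc (suc m)) × Fin (suc (suc m)))) where
  private
    n : ℕ
    n = suc m

  term-connected : numComponents A ≡ 1 → tutteTerm (wheel n) (+ 1) x A ≡ (x - + 1) ^ (length A ∸ n)
  term-connected one = begin
    (+ 1 - + 1) ^ (rank (E (wheel n)) ∸ rank A) * (x - + 1) ^ (length A ∸ rank A)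
      ≡⟨ cong₂ (λ a b → (+ 1 - + 1) ^ (a ∸ b) * (x - + 1) ^ (length A ∸ b)) (rank-wheel m) (cong (suc n ∸_) one) ⟩
    (+ 1 - + 1) ^ (n ∸ n) * (x - + 1) ^ (length A ∸ n)
      ≡⟨ cong (λ k → (+ 1 - + 1) ^ k * (x - + 1) ^ (length A ∸ n)) (ℕP.n∸n≡0 n) ⟩
    + 1 * (x - + 1) ^ (length A ∸ n)
      ≡⟨ ℤP.*-identityˡ _ ⟩
    (x - + 1) ^ (length A ∸ n) ∎
    where open ≡-Reasoning

  term-disconnected : 2 ≤ numComponents A → tutteTerm (wheel n) (+ 1) x A ≡ + 0
  term-disconnected two≤ = begin
    (+ 1 - + 1) ^ (rank (E (wheel n)) ∸ rank A) * (x - + 1) ^ (length A ∸ rank A)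
      ≡⟨ cong (λ k → (+ 1 - + 1) ^ k * (x - + 1) ^ (length A ∸ rank A)) positive-gap ⟩
    (+ 0) ^ suc (m ∸ rank A) * (x - + 1) ^ (length A ∸ rank A)
      ≡⟨ ℤP.*-zeroˡ ((x - + 1) ^ (length A ∸ rank A)) ⟩
    + 0 ∎
    where
    open ≡-Reasoning
    rankA≤m : rank A ≤ m
    rankA≤m = ℕP.∸-monoʳ-≤ (suc n) two≤
    positive-gap : rank (E (wheel n)) ∸ rank A ≡ suc (m ∸ rank A)
    positive-gap = trans (cong (_∸ rank A) (rank-wheel m)) (ℕP.+-∸-assoc 1 rankA≤m)

rim-spoke-balance : ∀ ρ σ h′ → T (ρ ∨ h′) →
                    [ ρ ]ℕ ℕ.+ [ σ ]ℕ ℕ.+ [ not (σ ∨ (ρ ∧ h′)) ]ℕ ≡ [ σ ∧ (ρ ∧ h′) ]ℕ ℕ.+ 1 ℕ.+ [ not h′ ]ℕ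
rim-spoke-balance true true true _ = refl
rim-spoke-balance true true false _ = refl
rim-spoke-balance true false true _ = refl
rim-spoke-balance true false false _ = refl
rim-spoke-balance false true true _ = refl
rim-spoke-balance false false true _ = refl

-- The weight of rim vertex i under a labelling H, where h = H i, h′ = H (next i), ρ says whether the
-- rim edge {i, next i} is present and σ whether the spoke {hub, i} is.
vertexWeight : ℤ → (h′ ρ σ h : Bool) → ℤ
vertexWeight z h′ ρ σ h =
  if does (h BP.≟ (σ ∨ (ρ ∧ h′))) ∧ (ρ ∨ h′) then (if σ ∧ (ρ ∧ h′) then z else + 1) else + 0

vertexWeight-≢0 : ∀ z h′ ρ σ h → vertexWeight z h′ ρ σ h ≢ + 0 → h ≡ σ ∨ (ρ ∧ h′)
vertexWeight-≢0 z h′ ρ σ h ≢0 with h BP.≟ (σ ∨ (ρ ∧ h′))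
... | yes eq = eq
... | no _ = ⊥-elim (≢0 refl)

vertexWeight-uncovered : ∀ z h′ ρ σ h → ¬ T (ρ ∨ h′) → vertexWeight z h′ ρ σ h ≡ + 0
vertexWeight-uncovered z h′ ρ σ h uncovered
  rewrite ¬T⇒≡false uncovered | BP.∧-zeroʳ (does (h BP.≟ (σ ∨ (ρ ∧ h′)))) = refl

vertexWeight-solution : ∀ z h′ ρ σ h → h ≡ σ ∨ (ρ ∧ h′) → T (ρ ∨ h′) →
                        vertexWeight z h′ ρ σ h ≡ (if σ ∧ (ρ ∧ h′) then z else + 1)
vertexWeight-solution z h′ ρ σ h eq covered
  rewrite to BP.T-≡ covered | dec-true (h BP.≟ (σ ∨ (ρ ∧ h′))) eq = refl

vertexWeight-∑ : ∀ x h′ h → let w = λ ρ σ → vertexWeight (x - + 1) h′ ρ σ h in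
                 (w false false + w false true) + (w true false + w true true) ≡ + 1 + [ h ∧ h′ ]ℤ * x
vertexWeight-∑ x false false = refl
vertexWeight-∑ x false true = refl
vertexWeight-∑ x true false = refl
vertexWeight-∑ x true true = both-hubward x
  where
  both-hubward : ∀ x → + 0 + + 1 + (+ 1 + (x - + 1)) ≡ + 1 + + 1 * x
  both-hubward = solve-∀

vertexWeight-cycle : ∀ z h → vertexWeight z h true false h ≡ + 1
vertexWeight-cycle z false = refl
vertexWeight-cycle z true = refl

module WheelSubgraph {m : ℕ} (r p : Fin (suc m) → Bool) where
  n : ℕ
  n = suc m

  edges : List (Fin (suc n) × Fin (suc n))
  edges = select rimEdge r ++ select spokeEdge p

  open Connectivity edges

  hub : Fin (suc n)
  hub = zero

  data Edge : Fin (suc n) → Fin (suc n) → Set where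
    rim : ∀ {i} → T (r i) → Edge (suc i) (suc (next i))
    spoke : ∀ {i} → T (p i) → Edge hub (suc i)

  edge-view : ∀ {a b} → (a , b) ∈ edges → Edge a b
  edge-view ab∈ with ∈-++⁻ (select rimEdge r) ab∈
  ... | inj₁ ab∈rims with ∈-select⁻ rimEdge r ab∈rims
  ...   | i , ri , refl = rim ri
  edge-view ab∈ | inj₂ ab∈spokes with ∈-select⁻ spokeEdge p ab∈spokes
  ...   | i , pi , refl = spoke pi

  rim-adjacent : ∀ {i} → T (r i) → Adjacent (suc i) (suc (next i))
  rim-adjacent ri = inj₁ (∈-++⁺ˡ (∈-select⁺ rimEdge r ri))

  spoke-adjacent : ∀ {i} → T (p i) → Adjacent (suc i) hub
  spoke-adjacent pi = inj₂ (∈-++⁺ʳ (select rimEdge r) (∈-select⁺ spokeEdge p pi))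

  -- reach k i: walking forward from rim vertex i along at most k − 1 rim edges, one meets a spoke.
  reach : ℕ → Fin n → Bool
  reach zero i = false
  reach (suc k) i = p i ∨ (r i ∧ reach k (next i))

  rimRun : ℕ → Fin n → Bool
  rimRun zero i = true
  rimRun (suc k) i = r i ∧ rimRun k (next i)

  hubward : Fin n → Bool
  hubward = reach n

  Solves : (Fin n → Bool) → Set
  Solves H = ∀ i → H i ≡ p i ∨ (r i ∧ H (next i))

  reach-path : ∀ k i → T (reach k i) → Path (suc i) hub
  reach-path (suc k) i t with to BP.T-∨ t
  ... | inj₁ pi = spoke-adjacent pi ◅ ε
  ... | inj₂ ri∧reach = let ri , reach′ = to BP.T-∧ ri∧reach in rim-adjacent ri ◅ reach-path k (next i) reach′

  unroll : ∀ {H} → Solves H → ∀ k i → H i ≡ reach k i ∨ (rimRun k i ∧ H (iterate next k i))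
  unroll solves zero i = refl
  unroll {H} solves (suc k) i =
    trans (solves i) (trans (cong (λ t → p i ∨ (r i ∧ t)) (unroll solves k (next i)))
                            (∨-∧-unroll (p i) (r i) (reach k (next i)) (rimRun k (next i)) (H (iterate next k (next i)))))

  reach-suc : ∀ k i → reach (suc k) i ≡ reach k i ∨ (rimRun k i ∧ p (iterate next k i))
  reach-suc zero i = trans (cong (p i ∨_) (BP.∧-zeroʳ (r i))) (BP.∨-identityʳ (p i))
  reach-suc (suc k) i =
    trans (cong (λ t → p i ∨ (r i ∧ t)) (reach-suc k (next i)))
          (∨-∧-unroll (p i) (r i) (reach k (next i)) (rimRun k (next i)) (p (iterate next k (next i))))

  hubward-solves : Solves hubward
  hubward-solves i = sym (begin
    reach (suc n) i                                     ≡⟨ reach-suc n i ⟩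
    reach n i ∨ (rimRun n i ∧ p (iterate next n i))     ≡⟨ cong (λ j → reach n i ∨ (rimRun n i ∧ p j)) (iterate-next-period i) ⟩
    reach n i ∨ (rimRun n i ∧ p i)                      ≡⟨ ∨-absorb (reach n i) (rimRun n i ∧ p i) spoke-reaches ⟩
    reach n i                                           ∎)
    where
    open ≡-Reasoning
    spoke-reaches : T (rimRun n i ∧ p i) → T (reach n i)
    spoke-reaches t = from (BP.T-∨ {p i}) (inj₁ (proj₂ (to (BP.T-∧ {rimRun n i}) t)))

  rimRun-r : ∀ {k i t} → T (rimRun k i) → t ℕ.< k → T (r (iterate next t i))
  rimRun-r {suc k} {i} {zero} run _ = proj₁ (to BP.T-∧ run)
  rimRun-r {suc k} {i} {suc t} run (s≤s t<k) = rimRun-r (proj₂ (to BP.T-∧ run)) t<k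

  rimRun-prefix : ∀ {k i t} → T (rimRun k i) → t ≤ k → T (rimRun t i)
  rimRun-prefix {t = zero} run _ = tt
  rimRun-prefix {suc k} {t = suc t} run (s≤s t≤k) =
    let ri , run′ = to BP.T-∧ run in from BP.T-∧ (ri , rimRun-prefix run′ t≤k)

  rimRun-snoc : ∀ {k i} → T (rimRun k i) → T (r (iterate next k i)) → T (rimRun (suc k) i)
  rimRun-snoc {zero} _ ri = from BP.T-∧ (ri , tt)
  rimRun-snoc {suc k} {i} run rk = let ri , run′ = to BP.T-∧ run in from BP.T-∧ (ri , rimRun-snoc {k} {next i} run′ rk)

  reach-hit : ∀ {k i t} → t ℕ.< k → T (rimRun t i) → T (p (iterate next t i)) → T (reach k i)
  reach-hit {suc k} {t = zero} _ _ pi = from BP.T-∨ (inj₁ pi)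
  reach-hit {suc k} {t = suc t} (s≤s t<k) run pt =
    let ri , run′ = to BP.T-∧ run in from BP.T-∨ (inj₂ (from BP.T-∧ (ri , reach-hit t<k run′ pt)))

  NonDegenerate : Set
  NonDegenerate = (∃[ j ] ¬ T (r j)) ⊎ (∃[ j ] T (p j))

  hubward-unique : NonDegenerate → ∀ {H} → Solves H → H ≗ hubward
  hubward-unique nondeg {H} solves i = begin
    H i                                            ≡⟨ unroll solves n i ⟩
    hubward i ∨ (rimRun n i ∧ H (iterate next n i)) ≡⟨ cong (λ j → hubward i ∨ (rimRun n i ∧ H j)) (iterate-next-period i) ⟩
    hubward i ∨ (rimRun n i ∧ H i)                 ≡⟨ ∨-absorb (hubward i) _ (full-run-reaches nondeg ∘ proj₁ ∘ to BP.T-∧) ⟩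
    hubward i                                      ∎
    where
    open ≡-Reasoning
    full-run-reaches : NonDegenerate → T (rimRun n i) → T (hubward i)
    full-run-reaches (inj₁ (j , ¬rj)) run =
      let k , k<n , i→j = next-reaches i j in ⊥-elim (¬rj (subst (T ∘ r) i→j (rimRun-r run k<n)))
    full-run-reaches (inj₂ (j , pj)) run =
      let k , k<n , i→j = next-reaches i j
      in reach-hit k<n (rimRun-prefix run (ℕP.<⇒≤ k<n)) (subst (T ∘ p) (sym i→j) pj)

  Covered : Set
  Covered = ∀ i → T (r i ∨ hubward (next i))

  covered-path-next : Covered → ∀ v → Path (suc v) hub → Path (suc (next v)) hub
  covered-path-next covered v path with T? (hubward (next v))
  ... | yes h = reach-path n (next v) h
  ... | no ¬h with to BP.T-∨ (covered v)
  ...   | inj₁ rv = swap (rim-adjacent rv) ◅ path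
  ...   | inj₂ h = ⊥-elim (¬h h)

  covered-path-iterate : Covered → ∀ k v → Path (suc v) hub → Path (suc (iterate next k v)) hub
  covered-path-iterate covered zero v path = path
  covered-path-iterate covered (suc k) v path = covered-path-iterate covered k (next v) (covered-path-next covered v path)

  some-hubward : NonDegenerate → Covered → ∃[ j ] T (hubward j)
  some-hubward (inj₁ (j , ¬rj)) covered with to BP.T-∨ (covered j)
  ... | inj₁ rj = ⊥-elim (¬rj rj)
  ... | inj₂ h = next j , h
  some-hubward (inj₂ (j , pj)) covered = j , from (BP.T-∨ {p j}) (inj₁ pj)

  covered-connected : NonDegenerate → Covered → ∀ u → Path u hub
  covered-connected nondeg covered zero = ε
  covered-connected nondeg covered (suc t) =
    let j , hj = some-hubward nondeg covered
        k , _ , j→t = next-reaches j t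
    in subst (λ v → Path (suc v) hub) j→t (covered-path-iterate covered k j (reach-path n j hj))

  uncovered-disconnected : ∀ i → ¬ T (r i) → ¬ T (hubward (next i)) → ¬ Path (suc (next i)) hub
  uncovered-disconnected i ¬ri ¬h path = on-run-closed path (zero , s≤s z≤n , refl , tt)
    where
    j : Fin n
    j = next i
    OnRun : Fin (suc n) → Set
    OnRun zero = ⊥
    OnRun (suc v) = ∃[ k ] (k ℕ.< n × iterate next k j ≡ v × T (rimRun k j))
    forward : ∀ {a} → T (r a) → OnRun (suc a) → OnRun (suc (next a))
    forward ra (k , k<n , j→a , run) with suc k ℕ.<? n
    ... | yes k+1<n = suc k , k+1<n , trans (iterate-comm next k j) (cong next j→a) ,
                      rimRun-snoc {k} {j} run (subst (T ∘ r) (sym j→a) ra)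
    ... | no k+1≮n = zero , s≤s z≤n , j≡next-a , tt
      where
      j≡next-a : j ≡ next _
      j≡next-a = begin
        j                          ≡⟨ iterate-next-period j ⟨
        iterate next n j           ≡⟨ cong (λ l → iterate next l j) (ℕP.≤-antisym (ℕP.≮⇒≥ k+1≮n) k<n) ⟩
        iterate next (suc k) j     ≡⟨ iterate-comm next k j ⟩
        next (iterate next k j)    ≡⟨ cong next j→a ⟩
        next _                     ∎
        where open ≡-Reasoning
    backward : ∀ {a} → T (r a) → OnRun (suc (next a)) → OnRun (suc a)
    backward {a} ra (zero , _ , j≡next-a , _) = ⊥-elim (¬ri (subst (T ∘ r) (sym (next-injective j≡next-a)) ra))
    backward {a} ra (suc k , k+1<n , j→next-a , run) =
      k , ℕP.<-trans (ℕP.n<1+n k) k+1<n ,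
      next-injective (trans (sym (iterate-comm next k j)) j→next-a) ,
      rimRun-prefix run (ℕP.n≤1+n k)
    no-spoke : ∀ {a} → T (p a) → ¬ OnRun (suc a)
    no-spoke pa (k , k<n , j→a , run) = ¬h (reach-hit k<n run (subst (T ∘ p) (sym j→a) pa))
    on-run-adjacent : ∀ {a b} → OnRun a → Adjacent a b → OnRun b
    on-run-adjacent onRun (inj₁ ab∈) with edge-view ab∈
    ... | rim ra = forward ra onRun
    on-run-adjacent onRun (inj₂ ba∈) with edge-view ba∈
    ... | rim ra = backward ra onRun
    ... | spoke pa = ⊥-elim (no-spoke pa onRun)
    on-run-closed : ∀ {a b} → Path a b → OnRun a → OnRun b
    on-run-closed ε onRun = onRun
    on-run-closed (adj ◅ path) onRun = on-run-closed path (on-run-adjacent onRun adj)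

  spokeless-disconnected : (∀ j → ¬ T (p j)) → ∀ i → ¬ Path (suc i) hub
  spokeless-disconnected ¬p i path = on-rim-closed path tt
    where
    OnRim : Fin (suc n) → Set
    OnRim zero = ⊥
    OnRim (suc _) = ⊤
    on-rim-adjacent : ∀ {a b} → OnRim a → Adjacent a b → OnRim b
    on-rim-adjacent onRim (inj₁ ab∈) with edge-view ab∈
    ... | rim _ = tt
    on-rim-adjacent onRim (inj₂ ba∈) with edge-view ba∈
    ... | rim _ = tt
    ... | spoke pa = ⊥-elim (¬p _ pa)
    on-rim-closed : ∀ {a b} → Path a b → OnRim a → OnRim b
    on-rim-closed ε onRim = onRim
    on-rim-closed (adj ◅ path) onRim = on-rim-closed path (on-rim-adjacent onRim adj)

  cycleSpoke : Fin n → Bool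
  cycleSpoke i = p i ∧ (r i ∧ hubward (next i))

  ∣cycleSpoke∣≡nullity : Covered → ∣ cycleSpoke ∣ ≡ length edges ∸ n
  ∣cycleSpoke∣≡nullity covered = sym (begin
    length edges ∸ n                                    ≡⟨ cong (_∸ n) length-edges ⟩
    ∣ r ∣ ℕ.+ ∣ p ∣ ∸ n                                 ≡⟨ cong (_∸ n) balance ⟩
    ∣ cycleSpoke ∣ ℕ.+ n ∸ n                            ≡⟨ ℕP.m+n∸n≡m ∣ cycleSpoke ∣ n ⟩
    ∣ cycleSpoke ∣                                      ∎)
    where
    open ≡-Reasoning
    ¬hubward : Fin n → Bool
    ¬hubward i = not (hubward i)
    length-edges : length edges ≡ ∣ r ∣ ℕ.+ ∣ p ∣
    length-edges = trans (LP.length-++ (select rimEdge r)) (cong₂ ℕ._+_ (length-select rimEdge r) (length-select spokeEdge p))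
    pointwise : ∀ i → [ r i ]ℕ ℕ.+ [ p i ]ℕ ℕ.+ [ ¬hubward i ]ℕ ≡ [ cycleSpoke i ]ℕ ℕ.+ 1 ℕ.+ [ ¬hubward (next i) ]ℕ
    pointwise i = trans (cong (λ b → [ r i ]ℕ ℕ.+ [ p i ]ℕ ℕ.+ [ not b ]ℕ) (hubward-solves i))
                        (rim-spoke-balance (r i) (p i) (hubward (next i)) (covered i))
    balance′ : ∣ r ∣ ℕ.+ ∣ p ∣ ℕ.+ ∣ ¬hubward ∣ ≡ ∣ cycleSpoke ∣ ℕ.+ n ℕ.+ ∣ ¬hubward ∣
    balance′ = begin
      ∣ r ∣ ℕ.+ ∣ p ∣ ℕ.+ ∣ ¬hubward ∣
        ≡⟨ cong (ℕ._+ ∣ ¬hubward ∣) (∑-distrib-+ (λ i → [ r i ]ℕ) (λ i → [ p i ]ℕ)) ⟨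
      ∑ (λ i → [ r i ]ℕ ℕ.+ [ p i ]ℕ) ℕ.+ ∣ ¬hubward ∣
        ≡⟨ ∑-distrib-+ (λ i → [ r i ]ℕ ℕ.+ [ p i ]ℕ) (λ i → [ ¬hubward i ]ℕ) ⟨
      ∑ (λ i → [ r i ]ℕ ℕ.+ [ p i ]ℕ ℕ.+ [ ¬hubward i ]ℕ)
        ≡⟨ ∑-cong pointwise ⟩
      ∑ (λ i → [ cycleSpoke i ]ℕ ℕ.+ 1 ℕ.+ [ ¬hubward (next i) ]ℕ)
        ≡⟨ ∑-distrib-+ (λ i → [ cycleSpoke i ]ℕ ℕ.+ 1) (λ i → [ ¬hubward (next i) ]ℕ) ⟩
      ∑ (λ i → [ cycleSpoke i ]ℕ ℕ.+ 1) ℕ.+ ∣ ¬hubward ∘ next ∣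
        ≡⟨ cong₂ ℕ._+_ (trans (∑-distrib-+ (λ i → [ cycleSpoke i ]ℕ) (λ _ → 1)) (cong (∣ cycleSpoke ∣ ℕ.+_) (∑-ones n)))
                       (∑-rotate (λ i → [ ¬hubward i ]ℕ)) ⟩
      ∣ cycleSpoke ∣ ℕ.+ n ℕ.+ ∣ ¬hubward ∣ ∎
    balance : ∣ r ∣ ℕ.+ ∣ p ∣ ≡ ∣ cycleSpoke ∣ ℕ.+ n
    balance = ℕP.+-cancelʳ-≡ ∣ ¬hubward ∣ _ _ balance′

  weight : ℤ → (Fin n → Bool) → ℤ
  weight z H = ∏ (λ i → vertexWeight z (H (next i)) (r i) (p i) (H i))

  weight-resp : ∀ z → weight z Preserves _≗_ ⟶ _≡_
  weight-resp z H≗H′ = ∏-cong (λ i → cong₂ (λ h′ h → vertexWeight z h′ (r i) (p i) h) (H≗H′ (next i)) (H≗H′ i))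

  weight-≢0⇒solves : ∀ z {H} → weight z H ≢ + 0 → Solves H
  weight-≢0⇒solves z {H} ≢0 i =
    vertexWeight-≢0 z (H (next i)) (r i) (p i) (H i) (≢0 ∘ ∏-zero (λ i → vertexWeight z (H (next i)) (r i) (p i) (H i)) i)

  weight-uncovered : ∀ z {H} i → ¬ T (r i ∨ H (next i)) → weight z H ≡ + 0
  weight-uncovered z {H} i uncovered =
    ∏-zero (λ i → vertexWeight z (H (next i)) (r i) (p i) (H i)) i (vertexWeight-uncovered z (H (next i)) (r i) (p i) (H i) uncovered)

  weight-hubward : ∀ z → Covered → weight z hubward ≡ z ^ (length edges ∸ n)
  weight-hubward z covered = begin
    weight z hubward
      ≡⟨ ∏-cong (λ i → vertexWeight-solution z _ (r i) (p i) _ (hubward-solves i) (covered i)) ⟩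
    ∏ (λ i → if cycleSpoke i then z else + 1)
      ≡⟨ ∏-if z cycleSpoke ⟩
    z ^ ∣ cycleSpoke ∣
      ≡⟨ cong (z ^_) (∣cycleSpoke∣≡nullity covered) ⟩
    z ^ (length edges ∸ n) ∎
    where open ≡-Reasoning

  module _ (x : ℤ) where
    open Components edges
    open WheelTerm x edges

    covered-weight≡term : NonDegenerate → Covered → weight (x - + 1) hubward ≡ tutteTerm (wheel n) (+ 1) x edges
    covered-weight≡term nondeg covered =
      trans (weight-hubward (x - + 1) covered)
            (sym (term-connected (connected⇒numComponents≡1 (covered-connected nondeg covered))))

    uncovered-weight≡term : ∀ i → ¬ T (r i ∨ hubward (next i)) → weight (x - + 1) hubward ≡ tutteTerm (wheel n) (+ 1) x edges
    uncovered-weight≡term i uncovered =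
      trans (weight-uncovered (x - + 1) {hubward} i uncovered)
            (sym (term-disconnected (disconnected⇒2≤numComponents (suc (next i)) (uncovered-disconnected i ¬ri ¬h))))
      where
      ¬ri : ¬ T (r i)
      ¬ri = uncovered ∘ from (BP.T-∨ {r i}) ∘ inj₁
      ¬h : ¬ T (hubward (next i))
      ¬h = uncovered ∘ from (BP.T-∨ {r i}) ∘ inj₂

    hubward-weight≡term : NonDegenerate → weight (x - + 1) hubward ≡ tutteTerm (wheel n) (+ 1) x edges
    hubward-weight≡term nondeg = by-cover (FP.all? (λ i → T? (r i ∨ hubward (next i))))
      where
      by-cover : Dec Covered → weight (x - + 1) hubward ≡ tutteTerm (wheel n) (+ 1) x edges
      by-cover (yes covered) = covered-weight≡term nondeg covered
      by-cover (no ¬covered) =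
        let i , uncovered = FP.¬∀⟶∃¬ n _ (λ i → T? (r i ∨ hubward (next i))) ¬covered in uncovered-weight≡term i uncovered

    ∑weight-nondegenerate : NonDegenerate → ∑[ H ⊆ n ] weight (x - + 1) H ≡ tutteTerm (wheel n) (+ 1) x edges
    ∑weight-nondegenerate nondeg =
      trans (∑⊆-single n (weight (x - + 1)) hubward (weight-resp (x - + 1)) off-hubward-vanishes) (hubward-weight≡term nondeg)
      where
      off-hubward-vanishes : ∀ H → ¬ H ≗ hubward → weight (x - + 1) H ≡ + 0
      off-hubward-vanishes H H≉ with weight (x - + 1) H ℤP.≟ + 0
      ... | yes ≡0 = ≡0
      ... | no ≢0 = ⊥-elim (H≉ (hubward-unique nondeg (weight-≢0⇒solves (x - + 1) {H} ≢0)))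

  solution-constant : (∀ j → T (r j)) → (∀ j → ¬ T (p j)) → ∀ {H} → Solves H → ∀ j → H j ≡ H zero
  solution-constant allRim noSpoke {H} solves j =
    let k , _ , 0→j = next-reaches zero j in trans (cong H (sym 0→j)) (sym (along k zero))
    where
    step-equal : ∀ i → H i ≡ H (next i)
    step-equal i =
      trans (solves i) (cong₂ (λ σ ρ → σ ∨ (ρ ∧ H (next i))) (¬T⇒≡false (noSpoke i)) (to BP.T-≡ (allRim i)))
    along : ∀ k i → H i ≡ H (iterate next k i)
    along zero i = refl
    along (suc k) i = trans (step-equal i) (along k (next i))

  ∑weight-spokeless-cycle : ∀ z → (∀ j → T (r j)) → (∀ j → ¬ T (p j)) → ∑⊆ n (weight z) ≡ + 2
  ∑weight-spokeless-cycle z allRim noSpoke =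
    trans (∑⊆-distrib-+ m (λ S → weight z (false V.∷ S)) (λ S → weight z (true V.∷ S)))
          (cong₂ _+_ (constant-branch false) (constant-branch true))
    where
    constant-weight : ∀ b → weight z (λ _ → b) ≡ + 1
    constant-weight b = ∏-one (λ i → vertexWeight z b (r i) (p i) b) (λ i →
      trans (cong₂ (λ ρ σ → vertexWeight z b ρ σ b) (to BP.T-≡ (allRim i)) (¬T⇒≡false (noSpoke i)))
            (vertexWeight-cycle z b))
    constant-branch : ∀ b → ∑[ S ⊆ m ] weight z (b V.∷ S) ≡ + 1
    constant-branch b =
      trans (∑⊆-single m (λ S → weight z (b V.∷ S)) (λ _ → b) resp vanish)
            (trans (weight-resp z {b V.∷ (λ _ → b)} {λ _ → b} (λ { zero → refl ; (suc i) → refl })) (constant-weight b))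
      where
      resp : (λ S → weight z (b V.∷ S)) Preserves _≗_ ⟶ _≡_
      resp {S} {S′} S≗S′ = weight-resp z {b V.∷ S} {b V.∷ S′} (λ { zero → refl ; (suc i) → S≗S′ i })
      vanish : ∀ S → ¬ S ≗ (λ _ → b) → weight z (b V.∷ S) ≡ + 0
      vanish S S≉ with weight z (b V.∷ S) ℤP.≟ + 0
      ... | yes ≡0 = ≡0
      ... | no ≢0 = ⊥-elim (S≉ (solution-constant allRim noSpoke (weight-≢0⇒solves z {b V.∷ S} ≢0) ∘ suc))


  isolatedCycle : ℤ
  isolatedCycle = ∏ (λ i → [ r i ]ℤ) * ∏ (λ i → [ not (p i) ]ℤ)

  nonDegenerate? : Dec NonDegenerate
  nonDegenerate? = FP.any? (λ j → ¬? (T? (r j))) ⊎-dec FP.any? (λ j → T? (p j))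

  nonDegenerate⇒isolatedCycle≡0 : NonDegenerate → isolatedCycle ≡ + 0
  nonDegenerate⇒isolatedCycle≡0 (inj₁ (j , ¬rj)) =
    cong (_* ∏ (λ i → [ not (p i) ]ℤ)) (∏-zero (λ i → [ r i ]ℤ) j (cong [_]ℤ (¬T⇒≡false ¬rj)))
  nonDegenerate⇒isolatedCycle≡0 (inj₂ (j , pj)) =
    trans (cong (∏ (λ i → [ r i ]ℤ) *_) (∏-zero (λ i → [ not (p i) ]ℤ) j (cong (λ b → [ not b ]ℤ) (to BP.T-≡ pj))))
          (ℤP.*-zeroʳ (∏ (λ i → [ r i ]ℤ)))

  degenerate-identity : ∀ x → ¬ NonDegenerate →
                        ∑[ H ⊆ n ] weight (x - + 1) H ≡ tutteTerm (wheel n) (+ 1) x edges + + 2 * isolatedCycle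
  degenerate-identity x degenerate = begin
    ∑[ H ⊆ n ] weight (x - + 1) H                          ≡⟨ ∑weight-spokeless-cycle (x - + 1) allRim noSpoke ⟩
    + 0 + + 2 * + 1                                        ≡⟨ cong₂ (λ t c → t + + 2 * c) hub-isolated isolated ⟨
    tutteTerm (wheel n) (+ 1) x edges + + 2 * isolatedCycle ∎
    where
    open ≡-Reasoning
    open Components edges
    open WheelTerm x edges
    allRim : ∀ j → T (r j)
    allRim j with T? (r j)
    ... | yes rj = rj
    ... | no ¬rj = ⊥-elim (degenerate (inj₁ (j , ¬rj)))
    noSpoke : ∀ j → ¬ T (p j)
    noSpoke j pj = degenerate (inj₂ (j , pj))
    hub-isolated : tutteTerm (wheel n) (+ 1) x edges ≡ + 0
    hub-isolated = term-disconnected (disconnected⇒2≤numComponents (suc zero) (spokeless-disconnected noSpoke zero))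
    isolated : isolatedCycle ≡ + 1
    isolated = cong₂ _*_ all-rim none-spoke
      where
      all-rim : ∏ (λ i → [ r i ]ℤ) ≡ + 1
      all-rim = ∏-one (λ i → [ r i ]ℤ) (λ i → cong [_]ℤ (to BP.T-≡ (allRim i)))
      none-spoke : ∏ (λ i → [ not (p i) ]ℤ) ≡ + 1
      none-spoke = ∏-one (λ i → [ not (p i) ]ℤ) (λ i → cong (λ b → [ not b ]ℤ) (¬T⇒≡false (noSpoke i)))

  ∑weight≡tutteTerm+2isolatedCycle : ∀ x → ∑[ H ⊆ n ] weight (x - + 1) H ≡ tutteTerm (wheel n) (+ 1) x edges + + 2 * isolatedCycle
  ∑weight≡tutteTerm+2isolatedCycle x = by-degeneracy nonDegenerate?
    where
    by-degeneracy : Dec NonDegenerate →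
                    ∑[ H ⊆ n ] weight (x - + 1) H ≡ tutteTerm (wheel n) (+ 1) x edges + + 2 * isolatedCycle
    by-degeneracy (yes nondeg) = begin
      ∑[ H ⊆ n ] weight (x - + 1) H                          ≡⟨ ∑weight-nondegenerate x nondeg ⟩
      tutteTerm (wheel n) (+ 1) x edges                      ≡⟨ ℤP.+-identityʳ (tutteTerm (wheel n) (+ 1) x edges) ⟨
      tutteTerm (wheel n) (+ 1) x edges + + 2 * + 0          ≡⟨ cong (λ c → tutteTerm (wheel n) (+ 1) x edges + + 2 * c)
                                                                     (nonDegenerate⇒isolatedCycle≡0 nondeg) ⟨
      tutteTerm (wheel n) (+ 1) x edges + + 2 * isolatedCycle ∎
      where open ≡-Reasoning
    by-degeneracy (no degenerate) = degenerate-identity x degenerate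

-- The transfer matrix

transferProduct : ∀ {n} → ℤ → (Fin n → Bool) → ℤ
transferProduct x H = ∏ (λ i → + 1 + [ H i ∧ H (next i) ]ℤ * x)

transferTrace : ℕ → ℤ → ℤ
transferTrace n x = ∑⊆ n (transferProduct x)

module _ (m : ℕ) (x : ℤ) where
  private
    n : ℕ
    n = suc m
    open WheelSubgraph {m} using (edges; weight; isolatedCycle; ∑weight≡tutteTerm+2isolatedCycle)

    term : (Fin n → Bool) → (Fin n → Bool) → ℤ
    term r p = tutteTerm (wheel n) (+ 1) x (edges r p)

    tutte-wheel≡∑∑term : tutte (wheel n) (+ 1) x ≡ ∑[ r ⊆ n ] ∑[ p ⊆ n ] term r p
    tutte-wheel≡∑∑term = begin
      ∑ᴸ (tutteTerm (wheel n) (+ 1) x) (sublists (E (wheel n)))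
        ≡⟨ cong (λ es → ∑ᴸ (tutteTerm (wheel n) (+ 1) x) (sublists es)) (E-wheel n) ⟩
      ∑ᴸ (tutteTerm (wheel n) (+ 1) x) (sublists (tabulate rimEdge ++ tabulate spokeEdge))
        ≡⟨ ∑ᴸ-sublists-++ (tutteTerm (wheel n) (+ 1) x) (tabulate rimEdge) (tabulate spokeEdge) ⟩
      ∑ᴸ (λ rims → ∑ᴸ (λ spokes → tutteTerm (wheel n) (+ 1) x (rims ++ spokes)) (sublists (tabulate spokeEdge)))
         (sublists (tabulate rimEdge))
        ≡⟨ ∑ᴸ-cong (λ rims → ∑ᴸ-sublists-tabulate n (λ spokes → tutteTerm (wheel n) (+ 1) x (rims ++ spokes)) spokeEdge)
                   (sublists (tabulate rimEdge)) ⟩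
      ∑ᴸ (λ rims → ∑[ p ⊆ n ] tutteTerm (wheel n) (+ 1) x (rims ++ select spokeEdge p)) (sublists (tabulate rimEdge))
        ≡⟨ ∑ᴸ-sublists-tabulate n (λ rims → ∑[ p ⊆ n ] tutteTerm (wheel n) (+ 1) x (rims ++ select spokeEdge p)) rimEdge ⟩
      ∑[ r ⊆ n ] ∑[ p ⊆ n ] term r p ∎
      where open ≡-Reasoning

    isolatedCycle-total : ∑[ r ⊆ n ] ∑[ p ⊆ n ] isolatedCycle r p ≡ + 1
    isolatedCycle-total = begin
      ∑[ r ⊆ n ] ∑[ p ⊆ n ] (∏ (λ i → [ r i ]ℤ) * ∏ (λ i → [ not (p i) ]ℤ))
        ≡⟨ ∑⊆-cong n (λ r → *-distribˡ-∑⊆ n (∏ (λ i → [ r i ]ℤ)) (λ p → ∏ (λ i → [ not (p i) ]ℤ))) ⟨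
      ∑[ r ⊆ n ] (∏ (λ i → [ r i ]ℤ) * ∑[ p ⊆ n ] ∏ (λ i → [ not (p i) ]ℤ))
        ≡⟨ ∑⊆-cong n (λ r → cong (∏ (λ i → [ r i ]ℤ) *_)
                                 (trans (∑⊆-∏ n (λ _ b → [ not b ]ℤ)) (∏-one {n} (λ _ → + 1 + + 0) (λ _ → refl)))) ⟩
      ∑[ r ⊆ n ] (∏ (λ i → [ r i ]ℤ) * + 1)
        ≡⟨ ∑⊆-cong n (λ r → ℤP.*-identityʳ (∏ (λ i → [ r i ]ℤ))) ⟩
      ∑[ r ⊆ n ] ∏ (λ i → [ r i ]ℤ)
        ≡⟨ trans (∑⊆-∏ n (λ _ b → [ b ]ℤ)) (∏-one {n} (λ _ → + 0 + + 1) (λ _ → refl)) ⟩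
      + 1 ∎
      where open ≡-Reasoning

    transfer-entry : ∀ H → ∑[ r ⊆ n ] ∑[ p ⊆ n ] weight r p (x - + 1) H ≡ transferProduct x H
    transfer-entry H = begin
      ∑[ r ⊆ n ] ∑[ p ⊆ n ] ∏ (λ i → w i (r i) (p i))
        ≡⟨ ∑⊆-cong n (λ r → ∑⊆-∏ n (λ i σ → w i (r i) σ)) ⟩
      ∑[ r ⊆ n ] ∏ (λ i → w i (r i) false + w i (r i) true)
        ≡⟨ ∑⊆-∏ n (λ i ρ → w i ρ false + w i ρ true) ⟩
      ∏ (λ i → (w i false false + w i false true) + (w i true false + w i true true))
        ≡⟨ ∏-cong (λ i → vertexWeight-∑ x (H (next i)) (H i)) ⟩
      transferProduct x H ∎
      where
      open ≡-Reasoning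
      w : Fin n → Bool → Bool → ℤ
      w i ρ σ = vertexWeight (x - + 1) (H (next i)) ρ σ (H i)

  tutte-wheel+2≡transferTrace : tutte (wheel n) (+ 1) x + + 2 ≡ transferTrace n x
  tutte-wheel+2≡transferTrace = begin
    tutte (wheel n) (+ 1) x + + 2
      ≡⟨ cong₂ (λ t c → t + + 2 * c) tutte-wheel≡∑∑term (sym isolatedCycle-total) ⟩
    ∑[ r ⊆ n ] ∑⊆ n (term r) + + 2 * ∑[ r ⊆ n ] ∑⊆ n (isolatedCycle r)
      ≡⟨ ∑⊆²-linear n n term isolatedCycle (+ 2) ⟨
    ∑[ r ⊆ n ] ∑[ p ⊆ n ] (term r p + + 2 * isolatedCycle r p)
      ≡⟨ ∑⊆-cong n (λ r → ∑⊆-cong n (λ p → ∑weight≡tutteTerm+2isolatedCycle r p x)) ⟨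
    ∑[ r ⊆ n ] ∑[ p ⊆ n ] ∑⊆ n (weight r p (x - + 1))
      ≡⟨ ∑⊆-cong n (λ r → ∑⊆-comm n n (λ p H → weight r p (x - + 1) H)) ⟩
    ∑[ r ⊆ n ] ∑[ H ⊆ n ] ∑[ p ⊆ n ] weight r p (x - + 1) H
      ≡⟨ ∑⊆-comm n n (λ r H → ∑[ p ⊆ n ] weight r p (x - + 1) H) ⟩
    ∑[ H ⊆ n ] ∑[ r ⊆ n ] ∑[ p ⊆ n ] weight r p (x - + 1) H
      ≡⟨ ∑⊆-cong n transfer-entry ⟩
    transferTrace n x ∎
    where open ≡-Reasoning

module _ (m : ℕ) (x : ℤ) where
  private
    n : ℕ
    n = suc m

    nonempty : (Fin n → Bool) → Bool
    nonempty A = any A (allFin n)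

    Allowed : (Fin n → Bool) → (Fin n → Bool) → Fin n → Bool
    Allowed A F i = not (F i) ∨ (A i ∧ A (next i))

    subgraphWeight : (Fin n → Bool) → (Fin n → Bool) → ℤ
    subgraphWeight A F = [ nonempty A ]ℤ * ∏ (λ i → [ Allowed A F i ]ℤ * x ^ [ F i ]ℕ)

    subgraphWeight-resp : ∀ A → subgraphWeight A Preserves _≗_ ⟶ _≡_
    subgraphWeight-resp A F≗F′ =
      cong ([ nonempty A ]ℤ *_) (∏-cong (λ i → cong (λ f → [ not f ∨ (A i ∧ A (next i)) ]ℤ * x ^ [ f ]ℕ) (F≗F′ i)))

    isCycleSubgraph-weight : ∀ A F → [ isCycleSubgraph (A , F) ]ℤ * x ^ card F ≡ subgraphWeight A F
    isCycleSubgraph-weight A F = begin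
      [ nonempty A ∧ all (Allowed A F) (allFin n) ]ℤ * x ^ card F
        ≡⟨ cong (_* x ^ card F) ([∧]ℤ (nonempty A) _) ⟩
      [ nonempty A ]ℤ * [ all (Allowed A F) (allFin n) ]ℤ * x ^ card F
        ≡⟨ ℤP.*-assoc [ nonempty A ]ℤ _ (x ^ card F) ⟩
      [ nonempty A ]ℤ * ([ all (Allowed A F) (allFin n) ]ℤ * x ^ card F)
        ≡⟨ cong ([ nonempty A ]ℤ *_) (cong₂ _*_ allowed-product power-product) ⟩
      [ nonempty A ]ℤ * (∏ (λ i → [ Allowed A F i ]ℤ) * ∏ (λ i → x ^ [ F i ]ℕ))
        ≡⟨ cong ([ nonempty A ]ℤ *_) (∏-distrib-* (λ i → [ Allowed A F i ]ℤ) (λ i → x ^ [ F i ]ℕ)) ⟨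
      subgraphWeight A F ∎
      where
      open ≡-Reasoning
      allowed-product : [ all (Allowed A F) (allFin n) ]ℤ ≡ ∏ (λ i → [ Allowed A F i ]ℤ)
      allowed-product =
        trans (cong (λ bs → [ and bs ]ℤ) (LP.map-tabulate (λ i → i) (Allowed A F))) ([and-tabulate]ℤ (Allowed A F))
      power-product : x ^ card F ≡ ∏ (λ i → x ^ [ F i ]ℕ)
      power-product = trans (cong (x ^_) (count-tabulate F (λ i → i))) (^-∣∣ x F)

    ∑subgraphWeight : ∀ A → ∑[ F ⊆ n ] subgraphWeight A F ≡ [ nonempty A ]ℤ * transferProduct x A
    ∑subgraphWeight A = begin
      ∑[ F ⊆ n ] subgraphWeight A F
        ≡⟨ *-distribˡ-∑⊆ n [ nonempty A ]ℤ (λ F → ∏ (λ i → [ Allowed A F i ]ℤ * x ^ [ F i ]ℕ)) ⟨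
      [ nonempty A ]ℤ * ∑[ F ⊆ n ] ∏ (λ i → [ Allowed A F i ]ℤ * x ^ [ F i ]ℕ)
        ≡⟨ cong ([ nonempty A ]ℤ *_) (∑⊆-∏ n (λ i f → [ not f ∨ (A i ∧ A (next i)) ]ℤ * x ^ [ f ]ℕ)) ⟩
      [ nonempty A ]ℤ * ∏ (λ i → + 1 + [ A i ∧ A (next i) ]ℤ * (x * + 1))
        ≡⟨ cong ([ nonempty A ]ℤ *_) (∏-cong (λ i → cong (λ y → + 1 + [ A i ∧ A (next i) ]ℤ * y) (ℤP.*-identityʳ x))) ⟩
      [ nonempty A ]ℤ * transferProduct x A ∎
      where open ≡-Reasoning

    nonempty-resp : nonempty Preserves _≗_ ⟶ _≡_
    nonempty-resp A≗A′ = cong or (LP.map-cong A≗A′ (allFin n))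

    transferProduct-resp : transferProduct {n} x Preserves _≗_ ⟶ _≡_
    transferProduct-resp A≗A′ = ∏-cong (λ i → cong₂ (λ a a′ → + 1 + [ a ∧ a′ ]ℤ * x) (A≗A′ i) (A≗A′ (next i)))

    pairs : List ((Fin n → Bool) × (Fin n → Bool))
    pairs = concatMap (λ A → map (A ,_) (subsetsFin n)) (subsetsFin n)

    ∑pairs≡∑nonempty : ∑ᴸ (λ q → [ isCycleSubgraph q ]ℤ * x ^ card (proj₂ q)) pairs ≡
                       ∑[ A ⊆ n ] ([ nonempty A ]ℤ * transferProduct x A)
    ∑pairs≡∑nonempty = begin
      ∑ᴸ (λ q → [ isCycleSubgraph q ]ℤ * x ^ card (proj₂ q)) pairs
        ≡⟨ ∑ᴸ-concatMap _ _ (subsetsFin n) ⟩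
      ∑ᴸ (λ A → ∑ᴸ (λ q → [ isCycleSubgraph q ]ℤ * x ^ card (proj₂ q)) (map (A ,_) (subsetsFin n))) (subsetsFin n)
        ≡⟨ ∑ᴸ-cong (λ A → trans (∑ᴸ-map _ (A ,_) (subsetsFin n))
                        (trans (∑ᴸ-cong (isCycleSubgraph-weight A) (subsetsFin n))
                               (∑ᴸ-subsetsFin n (subgraphWeight A) (subgraphWeight-resp A)))) (subsetsFin n) ⟩
      ∑ᴸ (λ A → ∑⊆ n (subgraphWeight A)) (subsetsFin n)
        ≡⟨ ∑ᴸ-cong ∑subgraphWeight (subsetsFin n) ⟩
      ∑ᴸ (λ A → [ nonempty A ]ℤ * transferProduct x A) (subsetsFin n)
        ≡⟨ ∑ᴸ-subsetsFin n _ (λ A≗A′ → cong₂ (λ b y → [ b ]ℤ * y) (nonempty-resp A≗A′) (transferProduct-resp A≗A′)) ⟩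
      ∑[ A ⊆ n ] ([ nonempty A ]ℤ * transferProduct x A) ∎
      where open ≡-Reasoning

    ∑empty≡1 : ∑[ A ⊆ n ] ([ not (nonempty A) ]ℤ * transferProduct x A) ≡ + 1
    ∑empty≡1 =
      trans (∑⊆-single n (λ A → [ not (nonempty A) ]ℤ * transferProduct x A) (λ _ → false) resp vanish) empty-product
      where
      resp : (λ A → [ not (nonempty A) ]ℤ * transferProduct x A) Preserves _≗_ ⟶ _≡_
      resp A≗A′ = cong₂ (λ b y → [ not b ]ℤ * y) (nonempty-resp A≗A′) (transferProduct-resp A≗A′)
      vanish : ∀ A → ¬ A ≗ (λ _ → false) → [ not (nonempty A) ]ℤ * transferProduct x A ≡ + 0
      vanish A A≉∅ = let i , Ai≢false = FP.¬∀⟶∃¬ n _ (λ i → A i BP.≟ false) A≉∅ in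
        cong (λ b → [ not b ]ℤ * transferProduct x A) (any-allFin-true A i (from BP.T-≡ (BP.¬-not Ai≢false)))
      empty-product : [ not (nonempty (λ _ → false)) ]ℤ * transferProduct {n} x (λ _ → false) ≡ + 1
      empty-product = cong₂ _*_ (cong (λ b → [ not b ]ℤ) (any-allFin-false {n} (λ _ → false) (λ _ ())))
                                (∏-one {n} (λ _ → + 1) (λ _ → refl))

    ∑nonempty+1≡transferTrace : ∑[ A ⊆ n ] ([ nonempty A ]ℤ * transferProduct x A) + + 1 ≡ transferTrace n x
    ∑nonempty+1≡transferTrace = begin
      ∑⊆ n (λ A → [ nonempty A ]ℤ * M A) + + 1
        ≡⟨ cong (λ t → ∑⊆ n (λ A → [ nonempty A ]ℤ * M A) + t) ∑empty≡1 ⟨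
      ∑⊆ n (λ A → [ nonempty A ]ℤ * M A) + ∑⊆ n (λ A → [ not (nonempty A) ]ℤ * M A)
        ≡⟨ ∑⊆-distrib-+ n (λ A → [ nonempty A ]ℤ * M A) (λ A → [ not (nonempty A) ]ℤ * M A) ⟨
      ∑[ A ⊆ n ] ([ nonempty A ]ℤ * M A + [ not (nonempty A) ]ℤ * M A)
        ≡⟨ ∑⊆-cong n (λ A → trans (sym (ℤP.*-distribʳ-+ (M A) [ nonempty A ]ℤ [ not (nonempty A) ]ℤ))
                                 (cong (_* M A) ([b]+[¬b]≡1 (nonempty A)))) ⟩
      ∑[ A ⊆ n ] (+ 1 * M A)
        ≡⟨ ∑⊆-cong n (λ A → ℤP.*-identityˡ (M A)) ⟩
      transferTrace n x ∎
      where
      open ≡-Reasoning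
      M : (Fin n → Bool) → ℤ
      M = transferProduct x

  cycleSubgraphs+1≡transferTrace : sumTo n (λ k → + a k n * x ^ k) + + 1 ≡ transferTrace n x
  cycleSubgraphs+1≡transferTrace = begin
    sumTo n (λ k → + a k n * x ^ k) + + 1
      ≡⟨ cong (_+ + 1) (sumTo-count x n isCycleSubgraph (card ∘ proj₂) card≤n pairs) ⟩
    ∑ᴸ (λ q → [ isCycleSubgraph q ]ℤ * x ^ card (proj₂ q)) pairs + + 1
      ≡⟨ cong (_+ + 1) ∑pairs≡∑nonempty ⟩
    ∑[ A ⊆ n ] ([ nonempty A ]ℤ * transferProduct x A) + + 1
      ≡⟨ ∑nonempty+1≡transferTrace ⟩
    transferTrace n x ∎
    where
    open ≡-Reasoning
    card≤n : ∀ q → card (proj₂ q) ≤ n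
    card≤n (_ , F) = subst (_≤ n) (sym (count-tabulate F (λ i → i))) (∣∣≤n F)

-- The identity holds for every n ≥ 1; the hypothesis 3 ≤ n is only used to exclude n = 0.
corollary3p11 : ∀ (n : ℕ) → 3 ≤ n → ∀ (x : ℤ) →
    + 1 + tutte (wheel n) (+ 1) x ≡ sumTo n (λ k → + a k n * x ^ k)
corollary3p11 zero () x
corollary3p11 (suc m) _ x = begin
  + 1 + tutte (wheel n) (+ 1) x                    ≡⟨ shift (tutte (wheel n) (+ 1) x) ⟩
  (tutte (wheel n) (+ 1) x + + 2) - + 1            ≡⟨ cong (_- + 1) (tutte-wheel+2≡transferTrace m x) ⟩
  transferTrace n x - + 1                          ≡⟨ cong (_- + 1) (cycleSubgraphs+1≡transferTrace m x) ⟨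
  (sumTo n (λ k → + a k n * x ^ k) + + 1) - + 1    ≡⟨ unshift (sumTo n (λ k → + a k n * x ^ k)) ⟩
  sumTo n (λ k → + a k n * x ^ k)                  ∎
  where
  open ≡-Reasoning
  n : ℕ
  n = suc m
  shift : ∀ t → + 1 + t ≡ (t + + 2) - + 1
  shift = solve-∀
  unshift : ∀ s → (s + + 1) - + 1 ≡ s
  unshift = solve-∀
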